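{- Let $G$ be a finite, simple, connected graph on $n$ vertices, let $\overline{G}$ be its complement, and let $G\cup\overline{G}$ (which is $K_n$) be their union on the common vertex set. Then $\sigma^-(G)+\sigma^-(\overline{G})\le\sigma^-(G\cup\overline{G})$, and equality holds if and only if $G$ is $K_{1,n-1}$ with $n$ even, or $K_n$.
   Context: For a finite simple graph $H$ on $n$ vertices (not necessarily connected), a parity-signature of $H$ is a map $\sigma:E(H)\to\{1,-1\}$ for which there is a partition $V(H)=V_1\cup V_2$ with $||V_1|-|V_2||\le1$ such that an edge has sign $-1$ (is negative) exactly when its ends lie in different sets. $\sigma^-(H)$ (the $rna$ number) is the minimum number of negative edges over all parity-signatures of $H$. -}

module Defs where

open import Data.Nat using (ℕ; zero; suc; _+_; _∸_; _⊓_; _≤_; _<ᵇ_; ∣_-_∣)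
open import Data.Bool using (Bool; true; false; not; _xor_; _∧_; _∨_; if_then_else_; T)
open import Data.Fin using (Fin; toℕ; _≟_)
open import Data.List using (List; []; _∷_; map; concatMap; foldr; allFin)
open import Data.Nat.ListAction using (sum)
open import Data.Vec using (Vec; lookup)
import Data.Vec as Vec
open import Data.Product using (Σ; _×_; _,_)
open import Relation.Binary.PropositionalEquality using (_≡_; _≢_)
open import Relation.Nullary.Decidable using (⌊_⌋)

record Graph (n : ℕ) : Set where
  field
    adj   : Fin n → Fin n → Bool
    adj-sym : ∀ u v → adj u v ≡ adj v u
    adj-irrefl : ∀ v → adj v v ≡ false
open Graph public

data Walk {n : ℕ} (G : Graph n) : Fin n → Fin n → Set where
  here : ∀ {u} → Walk G u u
  step : ∀ {u v w} → T (adj G u v) → Walk G v w → Walk G u w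

Connected : ∀ {n} → Graph n → Set
Connected G = ∀ u v → Walk G u v

neq : ∀ {n} → Fin n → Fin n → Bool
neq u v = not ⌊ u ≟ v ⌋

complement : ∀ {n} → Graph n → Graph n
complement G = record
  { adj = λ u v → neq u v ∧ not (adj G u v)
  ; adj-sym = λ u v → symC u v
  ; adj-irrefl = λ v → irrC v }
  where
  open import Relation.Binary.PropositionalEquality using (refl; cong₂; sym; cong)
  open import Relation.Nullary using (yes; no)
  neq-sym : ∀ u v → neq u v ≡ neq v u
  neq-sym u v with u ≟ v | v ≟ u
  ... | yes _ | yes _ = refl
  ... | no _ | no _ = refl
  ... | yes p | no q with q (sym p)
  ... | ()
  neq-sym u v | no q | yes p with q (sym p)
  ... | ()
  symC : ∀ u v → (neq u v ∧ not (adj G u v)) ≡ (neq v u ∧ not (adj G v u))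
  symC u v = cong₂ _∧_ (neq-sym u v) (cong not (Graph.adj-sym G u v))
  irrC : ∀ v → (neq v v ∧ not (adj G v v)) ≡ false
  irrC v with v ≟ v
  ... | yes _ = refl
  ... | no ¬p with ¬p refl
  ... | ()

_∪G_ : ∀ {n} → Graph n → Graph n → Graph n
G ∪G H = record
  { adj = λ u v → adj G u v ∨ adj H u v
  ; adj-sym = λ u v → cong₂ _∨_ (Graph.adj-sym G u v) (Graph.adj-sym H u v)
  ; adj-irrefl = λ v → cong₂ _∨_ (Graph.adj-irrefl G v) (Graph.adj-irrefl H v) }
  where open import Relation.Binary.PropositionalEquality using (cong₂)

b2n : Bool → ℕ
b2n true = 1
b2n false = 0

pairs : (n : ℕ) → List (Fin n × Fin n)
pairs n = concatMap (λ i → concatMap (λ j → if toℕ i <ᵇ toℕ j then (i , j) ∷ [] else []) (allFin n)) (allFin n)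

-- A 2-partition V = V₁ ∪ V₂ encoded by s : Fin n → Bool (true ↦ V₁).
Partition : ℕ → Set
Partition n = Fin n → Bool

size₁ : ∀ {n} → Partition n → ℕ
size₁ {n} s = sum (map (λ v → b2n (s v)) (allFin n))

Balanced : ∀ {n} → Partition n → Set
Balanced {n} s = ∣ size₁ s - (n ∸ size₁ s) ∣ ≤ 1

balanced? : ∀ {n} → Partition n → Bool
balanced? {n} s = ∣ size₁ s - (n ∸ size₁ s) ∣ <ᵇ 2

differ : Bool → Bool → Bool
differ a b = a xor b

-- number of negative edges of the parity-signature induced by s
negEdges : ∀ {n} → Graph n → Partition n → ℕ
negEdges {n} G s = sum (map (λ { (i , j) → b2n (adj G i j ∧ differ (s i) (s j)) }) (pairs n))

numEdges : ∀ {n} → Graph n → ℕ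
numEdges {n} G = sum (map (λ { (i , j) → b2n (adj G i j) }) (pairs n))

allVecs : (n : ℕ) → List (Vec Bool n)
allVecs zero = Vec.[] ∷ []
allVecs (suc n) = concatMap (λ v → (true Vec.∷ v) ∷ (false Vec.∷ v) ∷ []) (allVecs n)

-- σ⁻(H): minimum number of negative edges over all balanced partitions.
-- (The balanced list is never empty, so the initial value numEdges H,
-- an upper bound, never affects the result.)
rna : ∀ {n} → Graph n → ℕ
rna {n} G = foldr (λ v m → if balanced? (lookup v) then negEdges G (lookup v) ⊓ m else m)
                  (numEdges G) (allVecs n)

-- G is the star K_{1,n-1} (up to isomorphism): some centre c adjacent
-- exactly to all other vertices, no other edges.
IsStar : ∀ {n} → Graph n → Set
IsStar {n} G = Σ (Fin n) λ c → ∀ u v → adj G u v ≡ (neq u v ∧ (not (neq u c) ∨ not (neq v c)))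

IsComplete : ∀ {n} → Graph n → Set
IsComplete {n} G = ∀ u v → u ≢ v → adj G u v ≡ true

Even : ℕ → Set
Even n = Σ ℕ λ k → n ≡ k + k

-- For every partition, the cut edges of K_n split into those of G and those of its
-- complement, so rna G + rna Gᶜ ≤ rna K_n, with equality exactly when one balanced
-- partition is optimal for G and Gᶜ at once. Comparing such a partition with the one
-- obtained by swapping two vertices of opposite sides (and, for n odd, by moving one
-- vertex of the larger side) yields exact identities between same-side and cross
-- degrees. For connected G they force the cross adjacency to be uniform along one side,
-- and then G is complete or, with n even, a star. Conversely, the complement of K_n has
-- no edges, and every balanced partition of a star on 2k vertices cuts exactly k edges.

module Submission where

open import Defs
open import Data.Nat using (ℕ; zero; suc; _+_; _*_; _≤_; _≤?_; _∸_; _⊓_; _<ᵇ_; ∣_-_∣; z≤n; s≤s; s≤s⁻¹; _≟_)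
open import Data.Nat.Properties
open import Algebra.Properties.CommutativeMonoid.Sum +-0-commutativeMonoid
  using (sum-syntax; ∑-distrib-+; ∑-comm; sum-cong-≗) renaming (sum to ∑)
open import Data.Bool using (Bool; true; false; not; _xor_; _∧_; _∨_; if_then_else_)
open import Data.Bool.Properties
  using (T-≡; ∧-identityʳ; ∧-zeroʳ; xor-comm; xor-same; xor-inverseˡ; xor-inverseʳ; not-involutive; not-¬)
  renaming (_≟_ to _≟ᵇ_)
open import Data.Fin using (Fin; toℕ) renaming (zero to fzero; suc to fsuc; _≟_ to _≟ᶠ_)
open import Data.Fin.Properties using (toℕ-injective; any?)
open import Data.List using (List; []; _∷_; map; concatMap; foldr; allFin; tabulate; _++_)
open import Data.List.Properties using (map-++)
open import Data.Nat.ListAction using (sum)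
open import Data.Nat.ListAction.Properties using (sum-++)
open import Data.Vec using (Vec; lookup)
import Data.Vec as Vec
import Data.Vec.Functional as Vector
open import Data.Vec.Properties using (lookup∘tabulate)
open import Data.List.Membership.Propositional using (_∈_)
open import Data.List.Membership.Propositional.Properties using (∈-concatMap⁺)
open import Data.List.Relation.Unary.Any using (here; there)
import Data.List.Relation.Unary.Any as Any
open import Data.Product using (_×_; _,_; Σ; proj₁; proj₂)
open import Data.Sum using (_⊎_; inj₁; inj₂)
import Data.Sum
open import Data.Empty using (⊥; ⊥-elim)
open import Function using (_∘_)
open import Function.Bundles using (_⇔_; mk⇔; Equivalence)
open import Relation.Nullary using (yes; no; ¬_; ofʸ; ofⁿ)
open import Relation.Nullary.Decidable using (⌊_⌋; _×-dec_)
open import Relation.Binary.PropositionalEquality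
open import Data.Nat.Tactic.RingSolver using (solve-∀)

private variable
  n : ℕ

≤-+-≡⇒≡ : ∀ {a b c d} → a ≤ c → b ≤ d → a + b ≡ c + d → a ≡ c
≤-+-≡⇒≡ {a} {b} {c} {d} a≤c b≤d sums = ≤-antisym a≤c (+-cancelʳ-≤ b c a (begin
  c + b ≤⟨ +-monoʳ-≤ c b≤d ⟩
  c + d ≡⟨ sym sums ⟩
  a + b ∎))
  where open ≤-Reasoning

≤-from-doubles : ∀ {a b x y} → a + (x + x) ≡ b + (y + y) → b ≤ a → x ≤ y
≤-from-doubles {a} {b} {x} {y} e b≤a with x ≤? y
... | yes x≤y = x≤y
... | no x≰y = ⊥-elim (<⇒≱ (+-mono-< (≰⇒> x≰y) (≰⇒> x≰y)) (+-cancelˡ-≤ a _ _ (begin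
  a + (x + x) ≡⟨ e ⟩
  b + (y + y) ≤⟨ +-monoˡ-≤ (y + y) b≤a ⟩
  a + (y + y) ∎)))
  where open ≤-Reasoning

double-injective : ∀ {x y} → x + x ≡ y + y → x ≡ y
double-injective e = ≤-antisym (≤-from-doubles {a = 0} e ≤-refl) (≤-from-doubles {a = 0} (sym e) ≤-refl)

even≢odd′ : ∀ k r → k + k ≢ suc (r + r)
even≢odd′ k r e = even≢odd k r (trans (double k) (trans e (cong suc (sym (double r)))))
  where
  double : ∀ x → 2 * x ≡ x + x
  double x = cong (x +_) (+-identityʳ x)

agree : Bool → Bool → Bool
agree a b = not a xor b

agree-self : ∀ a → agree a a ≡ true
agree-self = xor-inverseˡ

agree-not : ∀ a → agree a (not a) ≡ false
agree-not a = xor-same (not a)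

agree-not-self : ∀ a → agree (not a) a ≡ false
agree-not-self true = refl
agree-not-self false = refl

agree⇒≡ : ∀ a b → agree a b ≡ true → b ≡ a
agree⇒≡ true true _ = refl
agree⇒≡ false false _ = refl

≡-or-≡not : ∀ a b → b ≡ a ⊎ b ≡ not a
≡-or-≡not true true = inj₁ refl
≡-or-≡not true false = inj₂ refl
≡-or-≡not false true = inj₂ refl
≡-or-≡not false false = inj₁ refl

≡not-sym : ∀ {a b} → a ≡ not b → b ≡ not a
≡not-sym {a} {b} a≡¬b = trans (sym (not-involutive b)) (cong not (sym a≡¬b))

b2n≡0 : ∀ {b} → b2n b ≡ 0 → b ≡ false
b2n≡0 {false} _ = refl

b2n≤1 : ∀ b → b2n b ≤ 1
b2n≤1 true = ≤-refl
b2n≤1 false = z≤n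

b2n-injective : ∀ a b → b2n a ≡ b2n b → a ≡ b
b2n-injective true true _ = refl
b2n-injective false false _ = refl

neq-self : ∀ (u : Fin n) → neq u u ≡ false
neq-self u with u ≟ᶠ u
... | yes _ = refl
... | no u≢u = ⊥-elim (u≢u refl)

neq-≢ : ∀ {u w : Fin n} → u ≢ w → neq u w ≡ true
neq-≢ {u = u} {w} u≢w with u ≟ᶠ w
... | yes u≡w = ⊥-elim (u≢w u≡w)
... | no _ = refl

adj⇒≢ : ∀ (X : Graph n) {u w} → adj X u w ≡ true → u ≢ w
adj⇒≢ X {u} uw refl with trans (sym uw) (adj-irrefl X u)
... | ()

∑-mono-≤ : {f g : Fin n → ℕ} → (∀ i → f i ≤ g i) → ∑ f ≤ ∑ g
∑-mono-≤ {zero} h = z≤n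
∑-mono-≤ {suc n} h = +-mono-≤ (h fzero) (∑-mono-≤ (h ∘ fsuc))

∑-zero : {f : Fin n → ℕ} → (∀ i → f i ≡ 0) → ∑ f ≡ 0
∑-zero {zero} h = refl
∑-zero {suc n} h = cong₂ _+_ (h fzero) (∑-zero (h ∘ fsuc))

∑-const-1 : ∀ n → ∑[ i < n ] 1 ≡ n
∑-const-1 zero = refl
∑-const-1 (suc n) = cong suc (∑-const-1 n)

zeroAt : Fin n → (Fin n → ℕ) → Fin n → ℕ
zeroAt u f i = if ⌊ i ≟ᶠ u ⌋ then 0 else f i

zeroAt-≢ : ∀ (u : Fin n) f {i} → i ≢ u → zeroAt u f i ≡ f i
zeroAt-≢ u f {i} i≢u with i ≟ᶠ u
... | yes i≡u = ⊥-elim (i≢u i≡u)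
... | no _ = refl

zeroAt-≡0 : ∀ (u : Fin n) f i → (i ≢ u → f i ≡ 0) → zeroAt u f i ≡ 0
zeroAt-≡0 u f i f≡0 with i ≟ᶠ u
... | yes _ = refl
... | no i≢u = f≡0 i≢u

zeroAt-cong : ∀ (u : Fin n) {f g} → (∀ i → i ≢ u → f i ≡ g i) → ∀ i → zeroAt u f i ≡ zeroAt u g i
zeroAt-cong u {f} {g} f≈g i with i ≟ᶠ u
... | yes _ = refl
... | no i≢u = f≈g i i≢u

∑-split : ∀ (u : Fin n) f → ∑ f ≡ f u + ∑ (zeroAt u f)
∑-split fzero f = refl
∑-split (fsuc u) f = begin
  f fzero + ∑ (f ∘ fsuc)                                ≡⟨ cong (f fzero +_) (∑-split u (f ∘ fsuc)) ⟩
  f fzero + (f (fsuc u) + ∑ (zeroAt u (f ∘ fsuc)))       ≡⟨ x+[y+z]≡y+[x+z] (f fzero) (f (fsuc u)) _ ⟩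
  f (fsuc u) + (f fzero + ∑ (zeroAt u (f ∘ fsuc)))       ≡⟨ cong (λ z → f (fsuc u) + (f fzero + z)) (sum-cong-≗ shift) ⟩
  f (fsuc u) + ∑ (zeroAt (fsuc u) f)                    ∎
  where
  open ≡-Reasoning
  x+[y+z]≡y+[x+z] : ∀ x y z → x + (y + z) ≡ y + (x + z)
  x+[y+z]≡y+[x+z] = solve-∀
  shift : ∀ i → zeroAt u (f ∘ fsuc) i ≡ zeroAt (fsuc u) f (fsuc i)
  shift i with i ≟ᶠ u
  ... | yes _ = refl
  ... | no _ = refl

term≤∑ : ∀ (f : Fin n → ℕ) i → f i ≤ ∑ f
term≤∑ f i = ≤-trans (m≤m+n _ _) (≤-reflexive (sym (∑-split i f)))

two-terms≤∑ : ∀ (f : Fin n → ℕ) {a b} → a ≢ b → f a + f b ≤ ∑ f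
two-terms≤∑ f {a} {b} a≢b = begin
  f a + f b                ≡⟨ cong (f a +_) (sym (zeroAt-≢ a f (a≢b ∘ sym))) ⟩
  f a + zeroAt a f b       ≤⟨ +-monoʳ-≤ (f a) (term≤∑ (zeroAt a f) b) ⟩
  f a + ∑ (zeroAt a f)     ≡⟨ sym (∑-split a f) ⟩
  ∑ f                      ∎
  where open ≤-Reasoning

∑≡0⇒term≡0 : ∀ (f : Fin n → ℕ) → ∑ f ≡ 0 → ∀ i → f i ≡ 0
∑≡0⇒term≡0 f ∑f≡0 i = n≤0⇒n≡0 (≤-trans (term≤∑ f i) (≤-reflexive ∑f≡0))

∑≢0⇒term≢0 : ∀ (f : Fin n → ℕ) → ∑ f ≢ 0 → Σ (Fin n) λ i → f i ≢ 0
∑≢0⇒term≢0 {zero} f ∑f≢0 = ⊥-elim (∑f≢0 refl)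
∑≢0⇒term≢0 {suc n} f ∑f≢0 with f fzero ≟ 0
... | no f0≢0 = fzero , f0≢0
... | yes f0≡0 =
  let i , fi≢0 = ∑≢0⇒term≢0 (f ∘ fsuc) (λ rest≡0 → ∑f≢0 (cong₂ _+_ f0≡0 rest≡0)) in fsuc i , fi≢0

sum-map-tabulate : ∀ {A : Set} (f : A → ℕ) (g : Fin n → A) → sum (map f (tabulate g)) ≡ ∑ (f ∘ g)
sum-map-tabulate {zero} f g = refl
sum-map-tabulate {suc n} f g = cong (f (g fzero) +_) (sum-map-tabulate f (g ∘ fsuc))

sum-map-allFin : (f : Fin n → ℕ) → sum (map f (allFin n)) ≡ ∑ f
sum-map-allFin f = sum-map-tabulate f (λ i → i)

sum-map-concatMap : ∀ {A B : Set} (h : B → ℕ) (F : A → List B) (xs : List A) →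
  sum (map h (concatMap F xs)) ≡ sum (map (λ x → sum (map h (F x))) xs)
sum-map-concatMap h F [] = refl
sum-map-concatMap h F (x ∷ xs) = begin
  sum (map h (F x ++ concatMap F xs))                  ≡⟨ cong sum (map-++ h (F x) (concatMap F xs)) ⟩
  sum (map h (F x) ++ map h (concatMap F xs))          ≡⟨ sum-++ (map h (F x)) _ ⟩
  sum (map h (F x)) + sum (map h (concatMap F xs))     ≡⟨ cong (sum (map h (F x)) +_) (sum-map-concatMap h F xs) ⟩
  sum (map h (F x)) + sum (map (λ x → sum (map h (F x))) xs) ∎
  where open ≡-Reasoning

pairSum : (Fin n → Fin n → ℕ) → ℕ
pairSum f = ∑ λ i → ∑ λ j → if toℕ i <ᵇ toℕ j then f i j else 0

sum-pairs : (h : Fin n × Fin n → ℕ) → sum (map h (pairs n)) ≡ pairSum (λ i j → h (i , j))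
sum-pairs {n} h = begin
  sum (map h (concatMap row (allFin n)))                ≡⟨ sum-map-concatMap h row (allFin n) ⟩
  sum (map (λ i → sum (map h (row i))) (allFin n))      ≡⟨ sum-map-allFin (λ i → sum (map h (row i))) ⟩
  ∑ (λ i → sum (map h (row i)))                         ≡⟨ sum-cong-≗ (λ i → trans (sum-map-concatMap h (cell i) (allFin n))
                                                                        (sum-map-allFin (λ j → sum (map h (cell i j))))) ⟩
  ∑ (λ i → ∑ λ j → sum (map h (cell i j)))              ≡⟨ sum-cong-≗ (λ i → sum-cong-≗ (λ j → sum-cell (toℕ i <ᵇ toℕ j) (i , j))) ⟩
  pairSum (λ i j → h (i , j))                           ∎
  where
  open ≡-Reasoning
  cell : Fin n → Fin n → List (Fin n × Fin n)
  cell i j = if toℕ i <ᵇ toℕ j then (i , j) ∷ [] else []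
  row : Fin n → List (Fin n × Fin n)
  row i = concatMap (cell i) (allFin n)
  sum-cell : ∀ b p → sum (map h (if b then p ∷ [] else [])) ≡ (if b then h p else 0)
  sum-cell true p = +-identityʳ (h p)
  sum-cell false p = refl

pairSum-double : (f : Fin n → Fin n → ℕ) → (∀ i j → f i j ≡ f j i) → (∀ i → f i i ≡ 0) →
  pairSum f + pairSum f ≡ ∑ (λ i → ∑ (f i))
pairSum-double f f-sym f-diag = begin
  pairSum f + pairSum f                       ≡⟨ cong (pairSum f +_) (trans (∑-comm below) (sum-cong-≗ λ i → sum-cong-≗ λ j →
                                                   cong (λ x → if toℕ j <ᵇ toℕ i then x else 0) (f-sym j i))) ⟩
  ∑ (λ i → ∑ (below i)) + ∑ (λ i → ∑ (above i)) ≡⟨ sym (∑-distrib-+ (λ i → ∑ (below i)) (λ i → ∑ (above i))) ⟩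
  ∑ (λ i → ∑ (below i) + ∑ (above i))         ≡⟨ sum-cong-≗ (λ i → sym (∑-distrib-+ (below i) (above i))) ⟩
  ∑ (λ i → ∑ λ j → below i j + above i j)     ≡⟨ sum-cong-≗ (λ i → sum-cong-≗ (λ j → below+above i j)) ⟩
  ∑ (λ i → ∑ (f i))                           ∎
  where
  open ≡-Reasoning
  below above : Fin _ → Fin _ → ℕ
  below i j = if toℕ i <ᵇ toℕ j then f i j else 0
  above i j = if toℕ j <ᵇ toℕ i then f i j else 0
  below+above : ∀ i j → below i j + above i j ≡ f i j
  below+above i j with toℕ i <ᵇ toℕ j | <ᵇ-reflects-< (toℕ i) (toℕ j)
                     | toℕ j <ᵇ toℕ i | <ᵇ-reflects-< (toℕ j) (toℕ i)
  ... | true  | ofʸ i<j | true  | ofʸ j<i = ⊥-elim (<-asym i<j j<i)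
  ... | true  | _       | false | _       = +-identityʳ _
  ... | false | _       | true  | _       = refl
  ... | false | ofⁿ i≮j | false | ofⁿ j≮i rewrite toℕ-injective (≤-antisym (≮⇒≥ j≮i) (≮⇒≥ i≮j)) = sym (f-diag j)

-- Cut edges, degrees and moving one vertex

cutEdge : Graph n → Partition n → Fin n → Fin n → ℕ
cutEdge X s i j = b2n (adj X i j ∧ differ (s i) (s j))

crossDeg : Graph n → Partition n → Fin n → ℕ
crossDeg X s u = ∑ (cutEdge X s u)

sameDeg : Graph n → Partition n → Fin n → ℕ
sameDeg X s u = ∑ λ w → b2n (adj X u w ∧ agree (s u) (s w))

cutEdge-sym : ∀ (X : Graph n) s i j → cutEdge X s i j ≡ cutEdge X s j i
cutEdge-sym X s i j = cong b2n (cong₂ _∧_ (adj-sym X i j) (xor-comm (s i) (s j)))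

cutEdge-self : ∀ (X : Graph n) s i → cutEdge X s i i ≡ 0
cutEdge-self X s i rewrite adj-irrefl X i = refl

negEdges≡pairSum : ∀ (X : Graph n) s → negEdges X s ≡ pairSum (cutEdge X s)
negEdges≡pairSum {n} X s = sum-pairs {n} _

negEdges-double : ∀ (X : Graph n) s → negEdges X s + negEdges X s ≡ ∑ (crossDeg X s)
negEdges-double X s rewrite negEdges≡pairSum X s = pairSum-double (cutEdge X s) (cutEdge-sym X s) (cutEdge-self X s)

flipAt : Partition n → Fin n → Partition n
flipAt s u i = if ⌊ i ≟ᶠ u ⌋ then not (s i) else s i

flipAt-≢ : ∀ (s : Partition n) u {i} → i ≢ u → flipAt s u i ≡ s i
flipAt-≢ s u {i} i≢u with i ≟ᶠ u
... | yes i≡u = ⊥-elim (i≢u i≡u)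
... | no _ = refl

flipAt-self : ∀ (s : Partition n) u → flipAt s u u ≡ not (s u)
flipAt-self s u with u ≟ᶠ u
... | yes _ = refl
... | no u≢u = ⊥-elim (u≢u refl)

-- twice the number of cut edges not incident to u
cutAvoiding : Graph n → Partition n → Fin n → ℕ
cutAvoiding X s u = ∑ (zeroAt u λ i → ∑ (zeroAt u (cutEdge X s i)))

∑crossDeg-split : ∀ (X : Graph n) s u → ∑ (crossDeg X s) ≡ crossDeg X s u + crossDeg X s u + cutAvoiding X s u
∑crossDeg-split X s u = begin
  ∑ (crossDeg X s)                                                   ≡⟨ ∑-split u (crossDeg X s) ⟩
  crossDeg X s u + ∑ (zeroAt u (crossDeg X s))                       ≡⟨ cong (crossDeg X s u +_) (sum-cong-≗ split-row) ⟩
  crossDeg X s u + ∑ (λ i → zeroAt u (λ i → cutEdge X s i u) i + zeroAt u avoiding i)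
                                                                     ≡⟨ cong (crossDeg X s u +_) (∑-distrib-+ _ (zeroAt u avoiding)) ⟩
  crossDeg X s u + (∑ (zeroAt u (λ i → cutEdge X s i u)) + cutAvoiding X s u)
                                                                     ≡⟨ cong (λ d → crossDeg X s u + (d + cutAvoiding X s u)) column ⟩
  crossDeg X s u + (crossDeg X s u + cutAvoiding X s u)              ≡⟨ sym (+-assoc (crossDeg X s u) _ _) ⟩
  crossDeg X s u + crossDeg X s u + cutAvoiding X s u                ∎
  where
  open ≡-Reasoning
  avoiding : Fin _ → ℕ
  avoiding i = ∑ (zeroAt u (cutEdge X s i))
  split-row : ∀ i → zeroAt u (crossDeg X s) i ≡ zeroAt u (λ i → cutEdge X s i u) i + zeroAt u avoiding i
  split-row i with i ≟ᶠ u
  ... | yes _ = refl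
  ... | no _ = ∑-split u (cutEdge X s i)
  column : ∑ (zeroAt u (λ i → cutEdge X s i u)) ≡ crossDeg X s u
  column = begin
    ∑ (zeroAt u (λ i → cutEdge X s i u))   ≡⟨ sum-cong-≗ (zeroAt-cong u (λ i _ → cutEdge-sym X s i u)) ⟩
    ∑ (zeroAt u (cutEdge X s u))           ≡⟨ cong (_+ ∑ (zeroAt u (cutEdge X s u))) (sym (cutEdge-self X s u)) ⟩
    cutEdge X s u u + ∑ (zeroAt u (cutEdge X s u)) ≡⟨ sym (∑-split u (cutEdge X s u)) ⟩
    crossDeg X s u                         ∎

cutAvoiding-flipAt : ∀ (X : Graph n) s u → cutAvoiding X (flipAt s u) u ≡ cutAvoiding X s u
cutAvoiding-flipAt X s u = sum-cong-≗ (zeroAt-cong u λ i i≢u → sum-cong-≗ (zeroAt-cong u λ j j≢u →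
  cong (λ d → b2n (adj X i j ∧ d)) (cong₂ differ (flipAt-≢ s u i≢u) (flipAt-≢ s u j≢u))))

crossDeg-flipAt : ∀ (X : Graph n) s u → crossDeg X (flipAt s u) u ≡ sameDeg X s u
crossDeg-flipAt X s u = sum-cong-≗ edge
  where
  edge : ∀ w → cutEdge X (flipAt s u) u w ≡ b2n (adj X u w ∧ agree (s u) (s w))
  edge w with w ≟ᶠ u
  ... | yes refl rewrite adj-irrefl X w = refl
  ... | no _ rewrite flipAt-self s u = refl

-- Moving u to the other side turns its cross edges into same-side edges and vice versa.
∑crossDeg-flipAt : ∀ (X : Graph n) s u →
  ∑ (crossDeg X (flipAt s u)) + (crossDeg X s u + crossDeg X s u) ≡ ∑ (crossDeg X s) + (sameDeg X s u + sameDeg X s u)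
∑crossDeg-flipAt X s u
  rewrite ∑crossDeg-split X (flipAt s u) u | ∑crossDeg-split X s u | cutAvoiding-flipAt X s u | crossDeg-flipAt X s u
  = swap-doubles (sameDeg X s u) (crossDeg X s u) (cutAvoiding X s u)
  where
  swap-doubles : ∀ a b r → a + a + r + (b + b) ≡ b + b + r + (a + a)
  swap-doubles = solve-∀

sideSize : Partition n → Bool → ℕ
sideSize s b = ∑ λ w → b2n (agree b (s w))

module Degrees (G : Graph n) where

  sameDeg≡0⇒¬adj : ∀ s u → sameDeg G s u ≡ 0 → ∀ w → s w ≡ s u → adj G u w ≡ false
  sameDeg≡0⇒¬adj s u deg≡0 w sw with ∑≡0⇒term≡0 _ deg≡0 w
  ... | uw≡0 rewrite sw | agree-self (s u) | ∧-identityʳ (adj G u w) = b2n≡0 uw≡0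

  crossDeg≡0⇒¬adj : ∀ s u → crossDeg G s u ≡ 0 → ∀ w → s w ≡ not (s u) → adj G u w ≡ false
  crossDeg≡0⇒¬adj s u deg≡0 w sw with ∑≡0⇒term≡0 _ deg≡0 w
  ... | uw≡0 rewrite sw | xor-inverseʳ (s u) | ∧-identityʳ (adj G u w) = b2n≡0 uw≡0

  ¬adj⇒crossDeg≡0 : ∀ s u → (∀ w → s w ≡ not (s u) → adj G u w ≡ false) → crossDeg G s u ≡ 0
  ¬adj⇒crossDeg≡0 s u no-cross = ∑-zero edge
    where
    edge : ∀ w → cutEdge G s u w ≡ 0
    edge w with ≡-or-≡not (s u) (s w)
    ... | inj₁ sw rewrite sw | xor-same (s u) | ∧-zeroʳ (adj G u w) = refl
    ... | inj₂ sw rewrite no-cross w sw = refl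

  2≤sameDeg : ∀ s u {a b} → a ≢ b → s a ≡ s u → s b ≡ s u → adj G u a ≡ true → adj G u b ≡ true → 2 ≤ sameDeg G s u
  2≤sameDeg s u {a} {b} a≢b sa sb ua ub = ≤-trans (≤-reflexive (sym (cong₂ _+_ (same-edge sa ua) (same-edge sb ub))))
                                                  (two-terms≤∑ _ a≢b)
    where
    same-edge : ∀ {w} → s w ≡ s u → adj G u w ≡ true → b2n (adj G u w ∧ agree (s u) (s w)) ≡ 1
    same-edge sw uw rewrite uw | sw | agree-self (s u) = refl

  crossDeg≡1 : ∀ s u c → s c ≡ not (s u) → adj G u c ≡ true →
    (∀ w → w ≢ c → s w ≡ not (s u) → adj G u w ≡ false) → crossDeg G s u ≡ 1
  crossDeg≡1 s u c sc uc others = trans (∑-split c (cutEdge G s u)) (cong₂ _+_ edge-c (∑-zero edge))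
    where
    edge-c : cutEdge G s u c ≡ 1
    edge-c rewrite uc | sc | xor-inverseʳ (s u) = refl
    edge : ∀ w → zeroAt c (cutEdge G s u) w ≡ 0
    edge w with w ≟ᶠ c
    ... | yes _ = refl
    ... | no w≢c with ≡-or-≡not (s u) (s w)
    ...   | inj₁ sw rewrite sw | xor-same (s u) | ∧-zeroʳ (adj G u w) = refl
    ...   | inj₂ sw rewrite others w w≢c sw = refl

  private
    Gᶜ : Graph n
    Gᶜ = complement G

  complement-edge+edge : ∀ u w P → b2n ((neq u w ∧ not (adj G u w)) ∧ P) + b2n (adj G u w ∧ P) ≡ b2n (neq u w ∧ P)
  complement-edge+edge u w P with adj G u w in uw
  ... | false rewrite ∧-identityʳ (neq u w) = +-identityʳ _
  ... | true rewrite neq-≢ (adj⇒≢ G uw) = refl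

  adj-complement : ∀ {u v} → u ≢ v → b2n (adj Gᶜ u v) + b2n (adj G u v) ≡ 1
  adj-complement {u} {v} u≢v with complement-edge+edge u v true
  ... | e rewrite ∧-identityʳ (neq u v ∧ not (adj G u v)) | ∧-identityʳ (adj G u v) | neq-≢ u≢v = e

  sameDeg-complement : ∀ s u → sameDeg Gᶜ s u + sameDeg G s u + 1 ≡ sideSize s (s u)
  sameDeg-complement s u = begin
    sameDeg Gᶜ s u + sameDeg G s u + 1                    ≡⟨ cong (_+ 1) (sym (∑-distrib-+ _ (λ w → b2n (adj G u w ∧ same w)))) ⟩
    ∑ (λ w → _ + b2n (adj G u w ∧ same w)) + 1            ≡⟨ cong (_+ 1) (sum-cong-≗ λ w → complement-edge+edge u w (same w)) ⟩
    ∑ (λ w → b2n (neq u w ∧ same w)) + 1                  ≡⟨ +-comm _ 1 ⟩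
    1 + ∑ (λ w → b2n (neq u w ∧ same w))                  ≡⟨ cong₂ _+_ (cong b2n (sym (agree-self (s u)))) (sum-cong-≗ off-diagonal) ⟩
    b2n (same u) + ∑ (zeroAt u (b2n ∘ same))              ≡⟨ sym (∑-split u (b2n ∘ same)) ⟩
    sideSize s (s u)                                      ∎
    where
    open ≡-Reasoning
    same : Fin n → Bool
    same w = agree (s u) (s w)
    off-diagonal : ∀ w → b2n (neq u w ∧ same w) ≡ zeroAt u (b2n ∘ same) w
    off-diagonal w with w ≟ᶠ u
    ... | yes refl rewrite neq-self u = refl
    ... | no w≢u rewrite neq-≢ (w≢u ∘ sym) = refl

  crossDeg-complement : ∀ s u → crossDeg Gᶜ s u + crossDeg G s u ≡ sideSize s (not (s u))
  crossDeg-complement s u = begin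
    crossDeg Gᶜ s u + crossDeg G s u                 ≡⟨ sym (∑-distrib-+ (cutEdge Gᶜ s u) (cutEdge G s u)) ⟩
    ∑ (λ w → cutEdge Gᶜ s u w + cutEdge G s u w)     ≡⟨ sum-cong-≗ (λ w → complement-edge+edge u w (differ (s u) (s w))) ⟩
    ∑ (λ w → b2n (neq u w ∧ differ (s u) (s w)))     ≡⟨ sum-cong-≗ other-side ⟩
    sideSize s (not (s u))                           ∎
    where
    open ≡-Reasoning
    other-side : ∀ w → b2n (neq u w ∧ differ (s u) (s w)) ≡ b2n (agree (not (s u)) (s w))
    other-side w with u ≟ᶠ w
    ... | yes refl rewrite not-involutive (s u) | xor-same (s u) = refl
    ... | no _ rewrite not-involutive (s u) = refl

  sameDeg+1≤sideSize : ∀ s u → sameDeg G s u + 1 ≤ sideSize s (s u)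
  sameDeg+1≤sideSize s u = ≤-trans (m≤n+m _ (sameDeg Gᶜ s u))
    (≤-reflexive (trans (sym (+-assoc (sameDeg Gᶜ s u) _ 1)) (sameDeg-complement s u)))

  sameDeg-full⇒adj : ∀ s u → sameDeg G s u + 1 ≡ sideSize s (s u) → ∀ w → u ≢ w → s w ≡ s u → adj G u w ≡ true
  sameDeg-full⇒adj s u full w u≢w sw with adj G u w in uw | ∑≡0⇒term≡0 _ no-missing w
    where
    no-missing : sameDeg Gᶜ s u ≡ 0
    no-missing = +-cancelʳ-≡ (sameDeg G s u + 1) _ _
      (trans (sym (+-assoc (sameDeg Gᶜ s u) _ 1)) (trans (sameDeg-complement s u) (sym full)))
  ... | true | _ = refl
  ... | false | missing rewrite neq-≢ u≢w | sw | agree-self (s u) with missing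
  ...   | ()

  adj⇒crossDeg-full : ∀ s u → (∀ w → s w ≡ not (s u) → adj G u w ≡ true) → crossDeg G s u ≡ sideSize s (not (s u))
  adj⇒crossDeg-full s u all-cross = trans (cong (_+ crossDeg G s u) (sym no-missing)) (crossDeg-complement s u)
    where
    missing : ∀ w → cutEdge Gᶜ s u w ≡ 0
    missing w with ≡-or-≡not (s u) (s w)
    ... | inj₁ sw rewrite sw | xor-same (s u) | ∧-zeroʳ (neq u w ∧ not (adj G u w)) = refl
    ... | inj₂ sw rewrite all-cross w sw | ∧-zeroʳ (neq u w) = refl
    no-missing : crossDeg Gᶜ s u ≡ 0
    no-missing = ∑-zero missing

sideSize-+ : ∀ (s : Partition n) b → sideSize s b + sideSize s (not b) ≡ n
sideSize-+ {n} s b = begin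
  sideSize s b + sideSize s (not b)                  ≡⟨ sym (∑-distrib-+ (λ w → b2n (agree b (s w))) _) ⟩
  ∑ (λ w → b2n (agree b (s w)) + b2n (agree (not b) (s w))) ≡⟨ sum-cong-≗ (λ w → one-side b (s w)) ⟩
  ∑[ w < n ] 1                                       ≡⟨ ∑-const-1 n ⟩
  n                                                  ∎
  where
  open ≡-Reasoning
  one-side : ∀ b x → b2n (agree b x) + b2n (agree (not b) x) ≡ 1
  one-side true true = refl
  one-side true false = refl
  one-side false true = refl
  one-side false false = refl

sideSize-flipAt : ∀ (s : Partition n) u b →
  sideSize (flipAt s u) b + b2n (agree b (s u)) ≡ sideSize s b + b2n (agree b (not (s u)))
sideSize-flipAt s u b
  rewrite ∑-split u (λ w → b2n (agree b (flipAt s u w))) | ∑-split u (λ w → b2n (agree b (s w))) | flipAt-self s u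
        | sum-cong-≗ (zeroAt-cong u {λ w → b2n (agree b (flipAt s u w))} {λ w → b2n (agree b (s w))}
                       (λ i i≢u → cong (b2n ∘ agree b) (flipAt-≢ s u i≢u)))
  = exchange (b2n (agree b (not (s u)))) (b2n (agree b (s u))) (∑ (zeroAt u (λ w → b2n (agree b (s w)))))
  where
  exchange : ∀ x y r → x + r + y ≡ y + r + x
  exchange = solve-∀

Near : ℕ → ℕ → Set
Near m r = m ≡ r ⊎ m ≡ suc r ⊎ r ≡ suc m

∣-∣≤1⇒Near : ∀ m r → ∣ m - r ∣ ≤ 1 → Near m r
∣-∣≤1⇒Near zero zero _ = inj₁ refl
∣-∣≤1⇒Near zero (suc zero) _ = inj₂ (inj₂ refl)
∣-∣≤1⇒Near (suc zero) zero _ = inj₂ (inj₁ refl)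
∣-∣≤1⇒Near zero (suc (suc r)) (s≤s ())
∣-∣≤1⇒Near (suc (suc m)) zero (s≤s ())
∣-∣≤1⇒Near (suc m) (suc r) d≤1 with ∣-∣≤1⇒Near m r d≤1
... | inj₁ e = inj₁ (cong suc e)
... | inj₂ (inj₁ e) = inj₂ (inj₁ (cong suc e))
... | inj₂ (inj₂ e) = inj₂ (inj₂ (cong suc e))

Near⇒∣-∣≤1 : ∀ m r → Near m r → ∣ m - r ∣ ≤ 1
Near⇒∣-∣≤1 zero zero _ = z≤n
Near⇒∣-∣≤1 zero (suc zero) _ = ≤-refl
Near⇒∣-∣≤1 (suc zero) zero _ = ≤-refl
Near⇒∣-∣≤1 (suc m) (suc r) near = Near⇒∣-∣≤1 m r (Data.Sum.map suc-injective (Data.Sum.map suc-injective suc-injective) near)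
Near⇒∣-∣≤1 zero (suc (suc r)) (inj₂ (inj₂ ()))
Near⇒∣-∣≤1 (suc (suc m)) zero (inj₂ (inj₁ ()))

sizes-Near : Partition n → Set
sizes-Near s = Near (sideSize s true) (sideSize s false)

Balanced⇔sizes-Near : (s : Partition n) → Balanced s ⇔ sizes-Near s
Balanced⇔sizes-Near {n} s = mk⇔
  (λ bal → ∣-∣≤1⇒Near _ _ (subst₂ (λ x y → ∣ x - y ∣ ≤ 1) size≡ rest≡ bal))
  (λ near → subst₂ (λ x y → ∣ x - y ∣ ≤ 1) (sym size≡) (sym rest≡) (Near⇒∣-∣≤1 _ _ near))
  where
  size≡ : size₁ s ≡ sideSize s true
  size≡ = sum-map-allFin (λ v → b2n (s v))
  rest≡ : n ∸ size₁ s ≡ sideSize s false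
  rest≡ = trans (cong₂ _∸_ (sym (sideSize-+ s true)) size≡) (m+n∸m≡n (sideSize s true) (sideSize s false))

nearlyHalved : ∀ n → Σ (Partition n) λ s → sideSize s true ≡ sideSize s false ⊎ sideSize s true ≡ suc (sideSize s false)
nearlyHalved zero = (λ ()) , inj₁ refl
nearlyHalved (suc n) with nearlyHalved n
... | s , inj₁ equal = (true Vector.∷ s) , inj₂ (cong suc equal)
... | s , inj₂ larger = (false Vector.∷ s) , inj₁ larger

balancedPartition : ∀ n → Σ (Partition n) Balanced
balancedPartition n = let s , sizes = nearlyHalved n in
  s , Equivalence.from (Balanced⇔sizes-Near s) (Data.Sum.map₂ inj₁ sizes)

-- The rna number is a minimum over balanced partitions

allVecs-complete : ∀ n (v : Vec Bool n) → v ∈ allVecs n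
allVecs-complete zero Vec.[] = here refl
allVecs-complete (suc n) (b Vec.∷ v) = ∈-concatMap⁺ _ (Any.map (λ { refl → head-in b }) (allVecs-complete n v))
  where
  head-in : ∀ b → (b Vec.∷ v) ∈ (true Vec.∷ v) ∷ (false Vec.∷ v) ∷ []
  head-in true = here refl
  head-in false = there (here refl)

negEdges-cong : ∀ (X : Graph n) {s t} → (∀ i → s i ≡ t i) → negEdges X s ≡ negEdges X t
negEdges-cong X {s} {t} s≗t = begin
  negEdges X s         ≡⟨ negEdges≡pairSum X s ⟩
  pairSum (cutEdge X s) ≡⟨ sum-cong-≗ (λ i → sum-cong-≗ λ j → cong (λ e → if toℕ i <ᵇ toℕ j then e else 0)
                                        (cong (λ d → b2n (adj X i j ∧ d)) (cong₂ differ (s≗t i) (s≗t j)))) ⟩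
  pairSum (cutEdge X t) ≡⟨ sym (negEdges≡pairSum X t) ⟩
  negEdges X t         ∎
  where open ≡-Reasoning

Balanced-cong : ∀ {s t : Partition n} → (∀ i → s i ≡ t i) → Balanced s → Balanced t
Balanced-cong {n} {s} {t} s≗t = subst (λ m → ∣ m - (n ∸ m) ∣ ≤ 1)
  (trans (sum-map-allFin (b2n ∘ s)) (trans (sum-cong-≗ (cong b2n ∘ s≗t)) (sym (sum-map-allFin (b2n ∘ t)))))

Balanced⇒balanced? : ∀ (s : Partition n) → Balanced s → balanced? s ≡ true
Balanced⇒balanced? s bal = Equivalence.to T-≡ (<⇒<ᵇ (s≤s bal))

balanced?⇒Balanced : ∀ (s : Partition n) → balanced? s ≡ true → Balanced s
balanced?⇒Balanced s b = s≤s⁻¹ (<ᵇ⇒< _ 2 (Equivalence.from T-≡ b))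

module Minimum (X : Graph n) where

  keepMin : Vec Bool n → ℕ → ℕ
  keepMin v m = if balanced? (lookup v) then negEdges X (lookup v) ⊓ m else m

  keepMin-≤ : ∀ v m → keepMin v m ≤ m
  keepMin-≤ v m with balanced? (lookup v)
  ... | true = m⊓n≤n _ m
  ... | false = ≤-refl

  foldr-≤ : ∀ {v} vs → v ∈ vs → balanced? (lookup v) ≡ true → foldr keepMin (numEdges X) vs ≤ negEdges X (lookup v)
  foldr-≤ (v ∷ vs) (here refl) bal rewrite bal = m⊓n≤m _ _
  foldr-≤ (w ∷ vs) (there v∈vs) bal = ≤-trans (keepMin-≤ w _) (foldr-≤ vs v∈vs bal)

  foldr-attained : ∀ vs → foldr keepMin (numEdges X) vs ≡ numEdges X ⊎
    Σ (Vec Bool n) λ v → balanced? (lookup v) ≡ true × foldr keepMin (numEdges X) vs ≡ negEdges X (lookup v)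
  foldr-attained [] = inj₁ refl
  foldr-attained (v ∷ vs) with balanced? (lookup v) in bal
  ... | false = foldr-attained vs
  ... | true with ≤-total (negEdges X (lookup v)) (foldr keepMin (numEdges X) vs)
  ...   | inj₁ v≤ = inj₂ (v , bal , m≤n⇒m⊓n≡m v≤)
  ...   | inj₂ ≥v with foldr-attained vs
  ...     | inj₁ e = inj₁ (trans (m≥n⇒m⊓n≡n ≥v) e)
  ...     | inj₂ (w , bal-w , e) = inj₂ (w , bal-w , trans (m≥n⇒m⊓n≡n ≥v) e)

  negEdges≤numEdges : ∀ s → negEdges X s ≤ numEdges X
  negEdges≤numEdges s = begin
    negEdges X s           ≡⟨ negEdges≡pairSum X s ⟩
    pairSum (cutEdge X s)  ≤⟨ ∑-mono-≤ (λ i → ∑-mono-≤ λ j → cut≤edge i j) ⟩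
    pairSum (λ i j → b2n (adj X i j)) ≡⟨ sym (sum-pairs {n} _) ⟩
    numEdges X             ∎
    where
    open ≤-Reasoning
    cut≤edge : ∀ i j → (if toℕ i <ᵇ toℕ j then cutEdge X s i j else 0) ≤ (if toℕ i <ᵇ toℕ j then b2n (adj X i j) else 0)
    cut≤edge i j with toℕ i <ᵇ toℕ j | adj X i j
    ... | false | _ = z≤n
    ... | true | true = b2n≤1 (differ (s i) (s j))
    ... | true | false = z≤n

rna≤negEdges : ∀ (X : Graph n) s → Balanced s → rna X ≤ negEdges X s
rna≤negEdges {n} X s bal = begin
  rna X                   ≤⟨ Minimum.foldr-≤ X (allVecs n) (allVecs-complete n v) (Balanced⇒balanced? (lookup v) (Balanced-cong {n} (sym ∘ v≗s) bal)) ⟩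
  negEdges X (lookup v)   ≡⟨ negEdges-cong X v≗s ⟩
  negEdges X s            ∎
  where
  open ≤-Reasoning
  v : Vec Bool n
  v = Vec.tabulate s
  v≗s : ∀ i → lookup v i ≡ s i
  v≗s = lookup∘tabulate s

rna-attained : ∀ (X : Graph n) → Σ (Partition n) λ s → Balanced s × rna X ≡ negEdges X s
rna-attained {n} X with Minimum.foldr-attained X (allVecs n)
... | inj₂ (v , bal , e) = lookup v , balanced?⇒Balanced (lookup v) bal , e
... | inj₁ e with balancedPartition n
...   | s , bal = s , bal , ≤-antisym (rna≤negEdges X s bal) (≤-trans (Minimum.negEdges≤numEdges X s) (≤-reflexive (sym e)))

-- Splitting the edge set

negEdges-∪ : ∀ (G H : Graph n) → (∀ u v → adj G u v ∧ adj H u v ≡ false) →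
  ∀ s → negEdges G s + negEdges H s ≡ negEdges (G ∪G H) s
negEdges-∪ {n} G H disjoint s = begin
  negEdges G s + negEdges H s                 ≡⟨ cong₂ _+_ (negEdges≡pairSum G s) (negEdges≡pairSum H s) ⟩
  pairSum (cutEdge G s) + pairSum (cutEdge H s) ≡⟨ sym (∑-distrib-+ (λ i → ∑ (below G i)) (λ i → ∑ (below H i))) ⟩
  ∑ (λ i → ∑ (below G i) + ∑ (below H i))     ≡⟨ sum-cong-≗ (λ i → sym (∑-distrib-+ (below G i) (below H i))) ⟩
  ∑ (λ i → ∑ λ j → below G i j + below H i j) ≡⟨ sum-cong-≗ (λ i → sum-cong-≗ λ j → union-pair i j) ⟩
  pairSum (cutEdge (G ∪G H) s)                ≡⟨ sym (negEdges≡pairSum (G ∪G H) s) ⟩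
  negEdges (G ∪G H) s                         ∎
  where
  open ≡-Reasoning
  below : Graph n → Fin n → Fin n → ℕ
  below X i j = if toℕ i <ᵇ toℕ j then cutEdge X s i j else 0
  union-edge : ∀ a h d → a ∧ h ≡ false → b2n (a ∧ d) + b2n (h ∧ d) ≡ b2n ((a ∨ h) ∧ d)
  union-edge true false d _ = +-identityʳ _
  union-edge false h d _ = refl
  union-pair : ∀ i j → below G i j + below H i j ≡ (if toℕ i <ᵇ toℕ j then cutEdge (G ∪G H) s i j else 0)
  union-pair i j with toℕ i <ᵇ toℕ j
  ... | true = union-edge (adj G i j) (adj H i j) (differ (s i) (s j)) (disjoint i j)
  ... | false = refl

complement-disjoint : ∀ (G : Graph n) u v → adj G u v ∧ adj (complement G) u v ≡ false
complement-disjoint G u v with adj G u v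
... | true = ∧-zeroʳ (neq u v)
... | false = refl

Optimal : Graph n → Partition n → Set
Optimal {n} X s = ∀ t → Balanced t → negEdges X s ≤ negEdges X t

module Split {A B K : Graph n} (split : ∀ s → negEdges A s + negEdges B s ≡ negEdges K s) where

  rna+rna≤rna : rna A + rna B ≤ rna K
  rna+rna≤rna = let s , bal , rna≡ = rna-attained K in begin
    rna A + rna B                 ≤⟨ +-mono-≤ (rna≤negEdges A s bal) (rna≤negEdges B s bal) ⟩
    negEdges A s + negEdges B s   ≡⟨ split s ⟩
    negEdges K s                  ≡⟨ sym rna≡ ⟩
    rna K                         ∎
    where open ≤-Reasoning

  rna≤rna+rna : ∀ c → (∀ t → Balanced t → negEdges A t ≡ c) → rna K ≤ rna A + rna B
  rna≤rna+rna c constant = let s , bal , rnaA≡ = rna-attained A ; t , bal-t , rnaB≡ = rna-attained B in begin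
    rna K                         ≤⟨ rna≤negEdges K t bal-t ⟩
    negEdges K t                  ≡⟨ sym (split t) ⟩
    negEdges A t + negEdges B t   ≡⟨ cong₂ _+_ (trans (constant t bal-t) (sym (trans rnaA≡ (constant s bal)))) (sym rnaB≡) ⟩
    rna A + rna B                 ∎
    where open ≤-Reasoning

  common-optimum : rna A + rna B ≡ rna K → Σ (Partition n) λ s → Balanced s × Optimal A s × Optimal B s
  common-optimum rna+rna≡rna = s , bal , optimal A B sums , optimal B A swapped-sums
    where
    s : Partition n
    s = proj₁ (rna-attained K)
    bal : Balanced s
    bal = proj₁ (proj₂ (rna-attained K))
    sums : rna A + rna B ≡ negEdges A s + negEdges B s
    sums = trans rna+rna≡rna (trans (proj₂ (proj₂ (rna-attained K))) (sym (split s)))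
    swapped-sums : rna B + rna A ≡ negEdges B s + negEdges A s
    swapped-sums = trans (+-comm (rna B) (rna A)) (trans sums (+-comm (negEdges A s) (negEdges B s)))
    optimal : ∀ X Y → rna X + rna Y ≡ negEdges X s + negEdges Y s → Optimal X s
    optimal X Y sums t bal-t = begin
      negEdges X s ≡⟨ sym (≤-+-≡⇒≡ (rna≤negEdges X s bal) (rna≤negEdges Y s bal) sums) ⟩
      rna X        ≤⟨ rna≤negEdges X t bal-t ⟩
      negEdges X t ∎
      where open ≤-Reasoning

-- Moving and swapping vertices

swapAt : Partition n → Fin n → Fin n → Partition n
swapAt s u v = flipAt (flipAt s u) v

module Swap (s : Partition n) {u v : Fin n} (sv : s v ≡ not (s u)) where

  v≢u : v ≢ u
  v≢u refl = not-¬ refl sv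

  private
    t : Partition n
    t = flipAt s u
    tv : t v ≡ not (s u)
    tv = trans (flipAt-≢ s u v≢u) sv

  sideSize-swapAt : ∀ b → sideSize (swapAt s u v) b ≡ sideSize s b
  sideSize-swapAt b = +-cancelʳ-≡ (b2n (agree b (not (s u)))) _ _ (trans move-v (sideSize-flipAt s u b))
    where
    move-v : sideSize (swapAt s u v) b + b2n (agree b (not (s u))) ≡ sideSize t b + b2n (agree b (s u))
    move-v with sideSize-flipAt t v b
    ... | e rewrite tv | not-involutive (s u) = e

  Balanced-swapAt : Balanced s → Balanced (swapAt s u v)
  Balanced-swapAt bal = Equivalence.from (Balanced⇔sizes-Near (swapAt s u v))
    (subst₂ Near (sym (sideSize-swapAt true)) (sym (sideSize-swapAt false)) (Equivalence.to (Balanced⇔sizes-Near s) bal))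

  module _ (X : Graph n) where

    private
      a : ℕ
      a = b2n (adj X v u)

    sameDeg-moved : sameDeg X t v ≡ sameDeg X s v + a
    sameDeg-moved = begin
      sameDeg X t v                          ≡⟨ ∑-split u after ⟩
      after u + ∑ (zeroAt u after)           ≡⟨ cong₂ _+_ edge-after (sum-cong-≗ (zeroAt-cong u unchanged)) ⟩
      a + ∑ (zeroAt u before)                ≡⟨ +-comm a _ ⟩
      ∑ (zeroAt u before) + a                ≡⟨ cong (λ b → b + ∑ (zeroAt u before) + a) (sym edge-before) ⟩
      before u + ∑ (zeroAt u before) + a     ≡⟨ cong (_+ a) (sym (∑-split u before)) ⟩
      sameDeg X s v + a                      ∎
      where
      open ≡-Reasoning
      after before : Fin n → ℕ
      after w = b2n (adj X v w ∧ agree (t v) (t w))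
      before w = b2n (adj X v w ∧ agree (s v) (s w))
      edge-after : after u ≡ a
      edge-after rewrite tv | flipAt-self s u | agree-self (not (s u)) | ∧-identityʳ (adj X v u) = refl
      edge-before : before u ≡ 0
      edge-before rewrite sv | not-involutive (s u) | xor-same (s u) | ∧-zeroʳ (adj X v u) = refl
      unchanged : ∀ w → w ≢ u → after w ≡ before w
      unchanged w w≢u rewrite flipAt-≢ s u v≢u | flipAt-≢ s u w≢u = refl

    crossDeg-moved : crossDeg X s v ≡ crossDeg X t v + a
    crossDeg-moved = begin
      crossDeg X s v                                 ≡⟨ ∑-split u (cutEdge X s v) ⟩
      cutEdge X s v u + ∑ (zeroAt u (cutEdge X s v)) ≡⟨ cong₂ _+_ edge-before (sum-cong-≗ (zeroAt-cong u unchanged)) ⟩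
      a + ∑ (zeroAt u (cutEdge X t v))               ≡⟨ +-comm a _ ⟩
      ∑ (zeroAt u (cutEdge X t v)) + a               ≡⟨ cong (λ b → b + ∑ (zeroAt u (cutEdge X t v)) + a) (sym edge-after) ⟩
      cutEdge X t v u + ∑ (zeroAt u (cutEdge X t v)) + a ≡⟨ cong (_+ a) (sym (∑-split u (cutEdge X t v))) ⟩
      crossDeg X t v + a                             ∎
      where
      open ≡-Reasoning
      edge-before : cutEdge X s v u ≡ a
      edge-before rewrite sv | xor-inverseˡ (s u) | ∧-identityʳ (adj X v u) = refl
      edge-after : cutEdge X t v u ≡ 0
      edge-after rewrite tv | flipAt-self s u | xor-same (not (s u)) | ∧-zeroʳ (adj X v u) = refl
      unchanged : ∀ w → w ≢ u → cutEdge X s v w ≡ cutEdge X t v w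
      unchanged w w≢u rewrite flipAt-≢ s u v≢u | flipAt-≢ s u w≢u = refl

    ∑crossDeg-swapAt : let Ou = crossDeg X s u ; Ov = crossDeg X s v ; Su = sameDeg X s u ; Sv = sameDeg X s v in
      ∑ (crossDeg X (swapAt s u v)) + ((Ou + Ov) + (Ou + Ov)) ≡ ∑ (crossDeg X s) + ((Su + Sv + a + a) + (Su + Sv + a + a))
    ∑crossDeg-swapAt = swap-arithmetic {Ds = ∑ (crossDeg X s)} {Dt = ∑ (crossDeg X t)} {Dw = ∑ (crossDeg X (swapAt s u v))}
                                       {Ou = crossDeg X s u} {Su = sameDeg X s u} {Sv = sameDeg X s v} {a = a}
                                       (∑crossDeg-flipAt X s u) (∑crossDeg-flipAt X t v) crossDeg-moved sameDeg-moved
      where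
      swap-arithmetic : ∀ {Ds Dt Dw Ou Su Ov Sv Otv Stv a} →
        Dt + (Ou + Ou) ≡ Ds + (Su + Su) → Dw + (Otv + Otv) ≡ Dt + (Stv + Stv) → Ov ≡ Otv + a → Stv ≡ Sv + a →
        Dw + ((Ou + Ov) + (Ou + Ov)) ≡ Ds + ((Su + Sv + a + a) + (Su + Sv + a + a))
      swap-arithmetic {Ds} {Dt} {Dw} {Ou} {Su} {Ov} {Sv} {Otv} {Stv} {a} move-u move-v refl refl = begin
        Dw + ((Ou + (Otv + a)) + (Ou + (Otv + a)))        ≡⟨ regroup₁ Dw Ou Otv a ⟩
        (Dw + (Otv + Otv)) + (Ou + Ou) + (a + a)          ≡⟨ cong (λ x → x + (Ou + Ou) + (a + a)) move-v ⟩
        (Dt + ((Sv + a) + (Sv + a))) + (Ou + Ou) + (a + a) ≡⟨ regroup₂ Dt Ou Sv a ⟩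
        (Dt + (Ou + Ou)) + (Sv + a + a + (Sv + a + a))    ≡⟨ cong (_+ (Sv + a + a + (Sv + a + a))) move-u ⟩
        (Ds + (Su + Su)) + (Sv + a + a + (Sv + a + a))    ≡⟨ regroup₃ Ds Su Sv a ⟩
        Ds + ((Su + Sv + a + a) + (Su + Sv + a + a))      ∎
        where
        open ≡-Reasoning
        regroup₁ : ∀ d o p a → d + ((o + (p + a)) + (o + (p + a))) ≡ (d + (p + p)) + (o + o) + (a + a)
        regroup₁ = solve-∀
        regroup₂ : ∀ d o q a → (d + ((q + a) + (q + a))) + (o + o) + (a + a) ≡ (d + (o + o)) + (q + a + a + (q + a + a))
        regroup₂ = solve-∀
        regroup₃ : ∀ d p q a → (d + (p + p)) + (q + a + a + (q + a + a)) ≡ d + ((p + q + a + a) + (p + q + a + a))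
        regroup₃ = solve-∀

module Local (X : Graph n) {s : Partition n} (opt : Optimal X s) where

  ∑crossDeg-minimal : ∀ t → Balanced t → ∑ (crossDeg X s) ≤ ∑ (crossDeg X t)
  ∑crossDeg-minimal t bal = begin
    ∑ (crossDeg X s)              ≡⟨ sym (negEdges-double X s) ⟩
    negEdges X s + negEdges X s   ≤⟨ +-mono-≤ (opt t bal) (opt t bal) ⟩
    negEdges X t + negEdges X t   ≡⟨ negEdges-double X t ⟩
    ∑ (crossDeg X t)              ∎
    where open ≤-Reasoning

  move : ∀ v → Balanced (flipAt s v) → crossDeg X s v ≤ sameDeg X s v
  move v bal = ≤-from-doubles (∑crossDeg-flipAt X s v) (∑crossDeg-minimal _ bal)

  swap : Balanced s → ∀ u v → s v ≡ not (s u) →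
    crossDeg X s u + crossDeg X s v ≤ sameDeg X s u + sameDeg X s v + b2n (adj X v u) + b2n (adj X v u)
  swap bal u v sv = ≤-from-doubles (Swap.∑crossDeg-swapAt s sv X) (∑crossDeg-minimal _ (Swap.Balanced-swapAt s sv bal))

-- A partition that is optimal for both G and its complement

Balanced-flipAt-larger : ∀ (s : Partition n) β v → sideSize s β ≡ suc (sideSize s (not β)) → s v ≡ β → Balanced (flipAt s v)
Balanced-flipAt-larger {n} s β v larger sv = Equivalence.from (Balanced⇔sizes-Near t) (near β (begin
  sideSize t (not β)          ≡⟨ trans (sym (+-identityʳ _)) (trans other-side (+-comm _ 1)) ⟩
  suc (sideSize s (not β))    ≡⟨ sym larger ⟩
  sideSize s β                ≡⟨ sym (trans (+-comm 1 _) (trans this-side (+-identityʳ _))) ⟩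
  suc (sideSize t β)          ∎))
  where
  open ≡-Reasoning
  t : Partition n
  t = flipAt s v
  this-side : sideSize t β + 1 ≡ sideSize s β + 0
  this-side with sideSize-flipAt s v β
  ... | e rewrite sv | agree-self β | agree-not β = e
  other-side : sideSize t (not β) + 0 ≡ sideSize s (not β) + 1
  other-side with sideSize-flipAt s v (not β)
  ... | e rewrite sv | agree-not-self β | agree-self (not β) = e
  near : ∀ β → sideSize t (not β) ≡ suc (sideSize t β) → sizes-Near t
  near true e = inj₂ (inj₂ e)
  near false e = inj₂ (inj₁ e)

SwapBalanced : Graph n → Partition n → Set
SwapBalanced {n} G s = ∀ u v → s v ≡ not (s u) →
  sameDeg G s u + sameDeg G s v + b2n (adj G v u) + b2n (adj G v u) ≡ crossDeg G s u + crossDeg G s v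

-- The local inequalities for G and Gᶜ add up to an identity between side sizes,
-- so each of them is an equality.
module CommonOptimum (G : Graph n) {s : Partition n} (optG : Optimal G s) (optGᶜ : Optimal (complement G) s) where

  private
    Gᶜ : Graph n
    Gᶜ = complement G

  open Degrees G

  swap-balance : Balanced s → SwapBalanced G s
  swap-balance bal u v sv = sym (≤-+-≡⇒≡ (Local.swap G optG bal u v sv) (Local.swap Gᶜ optGᶜ bal u v sv) totals)
    where
    open ≡-Reasoning
    Ou Ov Oᶜu Oᶜv Su Sv Sᶜu Sᶜv a aᶜ : ℕ
    Ou = crossDeg G s u ; Ov = crossDeg G s v ; Oᶜu = crossDeg Gᶜ s u ; Oᶜv = crossDeg Gᶜ s v
    Su = sameDeg G s u ; Sv = sameDeg G s v ; Sᶜu = sameDeg Gᶜ s u ; Sᶜv = sameDeg Gᶜ s v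
    a = b2n (adj G v u) ; aᶜ = b2n (adj Gᶜ v u)
    su : s u ≡ not (s v)
    su = trans (sym (not-involutive (s u))) (cong not (sym sv))
    totals : (Ou + Ov) + (Oᶜu + Oᶜv) ≡ (Su + Sv + a + a) + (Sᶜu + Sᶜv + aᶜ + aᶜ)
    totals = begin
      (Ou + Ov) + (Oᶜu + Oᶜv)                          ≡⟨ regroup₁ Ou Ov Oᶜu Oᶜv ⟩
      (Oᶜu + Ou) + (Oᶜv + Ov)                          ≡⟨ cong₂ _+_ (crossDeg-complement s u) (crossDeg-complement s v) ⟩
      sideSize s (not (s u)) + sideSize s (not (s v))  ≡⟨ cong₂ (λ x y → sideSize s x + sideSize s y) (sym sv) (sym su) ⟩
      sideSize s (s v) + sideSize s (s u)              ≡⟨ +-comm (sideSize s (s v)) _ ⟩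
      sideSize s (s u) + sideSize s (s v)              ≡⟨ sym (cong₂ _+_ (sameDeg-complement s u) (sameDeg-complement s v)) ⟩
      (Sᶜu + Su + 1) + (Sᶜv + Sv + 1)                  ≡⟨ cong (λ x → (Sᶜu + Su + x) + (Sᶜv + Sv + x)) (sym (adj-complement (Swap.v≢u s sv))) ⟩
      (Sᶜu + Su + (aᶜ + a)) + (Sᶜv + Sv + (aᶜ + a))    ≡⟨ regroup₂ Su Sv Sᶜu Sᶜv a aᶜ ⟩
      (Su + Sv + a + a) + (Sᶜu + Sᶜv + aᶜ + aᶜ)        ∎
      where
      regroup₁ : ∀ p q r t → (p + q) + (r + t) ≡ (r + p) + (t + q)
      regroup₁ = solve-∀
      regroup₂ : ∀ p q r t a b → (r + p + (b + a)) + (t + q + (b + a)) ≡ (p + q + a + a) + (r + t + b + b)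
      regroup₂ = solve-∀

  move-balance : ∀ β → sideSize s β ≡ suc (sideSize s (not β)) → ∀ v → s v ≡ β → sameDeg G s v ≡ crossDeg G s v
  move-balance β larger v sv = sym (≤-+-≡⇒≡ (Local.move G optG v bal) (Local.move Gᶜ optGᶜ v bal) totals)
    where
    bal : Balanced (flipAt s v)
    bal = Balanced-flipAt-larger s β v larger sv
    totals : crossDeg G s v + crossDeg Gᶜ s v ≡ sameDeg G s v + sameDeg Gᶜ s v
    totals = +-cancelʳ-≡ 1 _ _ (begin
      crossDeg G s v + crossDeg Gᶜ s v + 1     ≡⟨ cong (_+ 1) (trans (+-comm (crossDeg G s v) _) (crossDeg-complement s v)) ⟩
      sideSize s (not (s v)) + 1               ≡⟨ cong (λ b → sideSize s (not b) + 1) sv ⟩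
      sideSize s (not β) + 1                   ≡⟨ +-comm _ 1 ⟩
      suc (sideSize s (not β))                 ≡⟨ sym larger ⟩
      sideSize s β                             ≡⟨ cong (sideSize s) (sym sv) ⟩
      sideSize s (s v)                         ≡⟨ sym (sameDeg-complement s v) ⟩
      sameDeg Gᶜ s v + sameDeg G s v + 1       ≡⟨ cong (_+ 1) (+-comm (sameDeg Gᶜ s v) _) ⟩
      sameDeg G s v + sameDeg Gᶜ s v + 1       ∎)
      where open ≡-Reasoning

-- Structure of connected graphs with a swap-balanced partition

isolated-walk : ∀ (G : Graph n) {u v} → (∀ w → adj G u w ≡ false) → Walk G u v → u ≡ v
isolated-walk G isolated here = refl
isolated-walk G {u} isolated (step {v = w} uw _) with trans (sym (Equivalence.to T-≡ uw)) (isolated w)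
... | ()

walk-crosses : ∀ (G : Graph n) (s : Partition n) {u v} → Walk G u v → s v ≡ not (s u) →
  Σ (Fin n) λ x → Σ (Fin n) λ y → adj G x y ≡ true × s y ≡ not (s x)
walk-crosses G s {u} here sv = ⊥-elim (not-¬ refl sv)
walk-crosses G s {u} (step {v = w} uw rest) sv with ≡-or-≡not (s u) (s w)
... | inj₂ sw = u , w , Equivalence.to T-≡ uw , sw
... | inj₁ sw = walk-crosses G s rest (trans sv (cong not (sym sw)))

nonempty-side : ∀ (s : Partition n) β → sideSize s β ≢ 0 → Σ (Fin n) λ w → s w ≡ β
nonempty-side s β nonempty with ∑≢0⇒term≢0 _ nonempty
... | w , counted = w , agree⇒≡ β (s w) (b2n≢0 counted)
  where
  b2n≢0 : ∀ {b} → b2n b ≢ 0 → b ≡ true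
  b2n≢0 {true} _ = refl
  b2n≢0 {false} zero≢0 = ⊥-elim (zero≢0 refl)

module Structure (G : Graph n) (connected : Connected G) (s : Partition n) (balanced-swaps : SwapBalanced G s) where

  open Degrees G

  private
    S O : Fin n → ℕ
    S = sameDeg G s
    O = crossDeg G s
    A : Fin n → Fin n → ℕ
    A x y = b2n (adj G x y)

  not-isolated : ∀ u v → s v ≡ not (s u) → S u ≡ 0 → O u ≡ 0 → ⊥
  not-isolated u v sv S≡0 O≡0 with isolated-walk G isolated (connected u v)
    where
    isolated : ∀ w → adj G u w ≡ false
    isolated w with ≡-or-≡not (s u) (s w)
    ... | inj₁ sw = sameDeg≡0⇒¬adj s u S≡0 w sw
    ... | inj₂ sw = crossDeg≡0⇒¬adj s u O≡0 w sw
  ... | refl = not-¬ refl sv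

  module Odd (β : Bool) (larger : sideSize s β ≡ suc (sideSize s (not β))) (moves : ∀ v → s v ≡ β → S v ≡ O v) where

    private
      larger-nonempty : sideSize s β ≢ 0
      larger-nonempty e = 1+n≢0 (trans (sym larger) e)
      v₀ : Fin n
      v₀ = proj₁ (nonempty-side s β larger-nonempty)
      sv₀ : s v₀ ≡ β
      sv₀ = proj₂ (nonempty-side s β larger-nonempty)

    smaller-balance : ∀ u v → s u ≡ not β → s v ≡ β → S u + A v u + A v u ≡ O u
    smaller-balance u v su sv = +-cancelʳ-≡ (S v) _ _ (begin
      S u + A v u + A v u + S v  ≡⟨ regroup (S u) (S v) (A v u) ⟩
      S u + S v + A v u + A v u  ≡⟨ balanced-swaps u v (trans sv (≡not-sym su)) ⟩
      O u + O v                  ≡⟨ cong (O u +_) (sym (moves v sv)) ⟩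
      O u + S v                  ∎)
      where
      open ≡-Reasoning
      regroup : ∀ a b c → a + c + c + b ≡ a + b + c + c
      regroup = solve-∀

    larger-uniform : ∀ u v → s u ≡ not β → s v ≡ β → adj G v u ≡ adj G v₀ u
    larger-uniform u v su sv = b2n-injective _ _ (double-injective (+-cancelˡ-≡ (S u) _ _ (begin
      S u + (A v u + A v u)    ≡⟨ sym (+-assoc (S u) _ _) ⟩
      S u + A v u + A v u      ≡⟨ smaller-balance u v su sv ⟩
      O u                      ≡⟨ sym (smaller-balance u v₀ su sv₀) ⟩
      S u + A v₀ u + A v₀ u    ≡⟨ +-assoc (S u) _ _ ⟩
      S u + (A v₀ u + A v₀ u)  ∎)))
      where open ≡-Reasoning

    -- u is adjacent to all of the larger side or to none of it, and in the latter case it is isolated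
    smaller-adj : ∀ u → s u ≡ not β → ∀ w → u ≢ w → adj G u w ≡ true
    smaller-adj u su with adj G v₀ u in v₀u
    ... | false = ⊥-elim (not-isolated u v₀ (trans sv₀ (≡not-sym su)) S≡0 O≡0)
      where
      O≡0 : O u ≡ 0
      O≡0 = ¬adj⇒crossDeg≡0 s u λ w sw → trans (adj-sym G u w)
              (trans (larger-uniform u w su (trans sw (sym (≡not-sym su)))) v₀u)
      S≡0 : S u ≡ 0
      S≡0 = begin
        S u                      ≡⟨ sym (trans (+-identityʳ _) (+-identityʳ _)) ⟩
        S u + 0 + 0              ≡⟨ cong (λ a → S u + a + a) (sym (cong b2n v₀u)) ⟩
        S u + A v₀ u + A v₀ u    ≡⟨ smaller-balance u v₀ su sv₀ ⟩
        O u                      ≡⟨ O≡0 ⟩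
        0                        ∎
        where open ≡-Reasoning
    ... | true = adjacent
      where
      cross : ∀ w → s w ≡ not (s u) → adj G u w ≡ true
      cross w sw = trans (adj-sym G u w) (trans (larger-uniform u w su (trans sw (sym (≡not-sym su)))) v₀u)
      full : S u + 1 ≡ sideSize s (s u)
      full = +-cancelʳ-≡ 1 _ _ (begin
        S u + 1 + 1              ≡⟨ cong (λ a → S u + a + a) (sym (cong b2n v₀u)) ⟩
        S u + A v₀ u + A v₀ u    ≡⟨ smaller-balance u v₀ su sv₀ ⟩
        O u                      ≡⟨ adj⇒crossDeg-full s u cross ⟩
        sideSize s (not (s u))   ≡⟨ cong (sideSize s) (sym (≡not-sym su)) ⟩
        sideSize s β             ≡⟨ larger ⟩
        suc (sideSize s (not β)) ≡⟨ cong (suc ∘ sideSize s) (sym su) ⟩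
        suc (sideSize s (s u))   ≡⟨ +-comm 1 _ ⟩
        sideSize s (s u) + 1     ∎)
        where open ≡-Reasoning
      adjacent : ∀ w → u ≢ w → adj G u w ≡ true
      adjacent w u≢w with ≡-or-≡not (s u) (s w)
      ... | inj₁ sw = sameDeg-full⇒adj s u full w u≢w sw
      ... | inj₂ sw = cross w sw

    larger-adj : ∀ v → s v ≡ β → ∀ w → v ≢ w → adj G v w ≡ true
    larger-adj v sv w v≢w with ≡-or-≡not (s v) (s w)
    ... | inj₂ sw = trans (adj-sym G v w) (smaller-adj w (trans sw (cong not sv)) v (v≢w ∘ sym))
    ... | inj₁ sw = sameDeg-full⇒adj s v full w v≢w sw
      where
      cross : ∀ x → s x ≡ not (s v) → adj G v x ≡ true
      cross x sx = trans (adj-sym G v x) (smaller-adj x (trans sx (cong not sv)) v (λ x≡v → not-¬ (cong s x≡v) sx))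
      full : S v + 1 ≡ sideSize s (s v)
      full = begin
        S v + 1                  ≡⟨ cong (_+ 1) (trans (moves v sv) (adj⇒crossDeg-full s v cross)) ⟩
        sideSize s (not (s v)) + 1 ≡⟨ cong (λ b → sideSize s (not b) + 1) sv ⟩
        sideSize s (not β) + 1   ≡⟨ +-comm _ 1 ⟩
        suc (sideSize s (not β)) ≡⟨ sym larger ⟩
        sideSize s β             ≡⟨ cong (sideSize s) (sym sv) ⟩
        sideSize s (s v)         ∎
        where open ≡-Reasoning

    complete : IsComplete G
    complete x y x≢y with ≡-or-≡not β (s x)
    ... | inj₁ sx = larger-adj x sx y x≢y
    ... | inj₂ sx = smaller-adj x sx y x≢y

  rectangle : ∀ u u' v v' → s v ≡ not (s u) → s v' ≡ not (s u) → s u' ≡ s u → A v u + A v' u' ≡ A v' u + A v u'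
  rectangle u u' v v' sv sv' su' = rectangle-arithmetic {su = S u} {S u'} {S v} {S v'} {O u} {O u'} {O v} {O v'}
    (balanced-swaps u v sv) (balanced-swaps u' v' (trans sv' (cong not (sym su'))))
    (balanced-swaps u v' sv') (balanced-swaps u' v (trans sv (cong not (sym su'))))
    where
    -- the degrees cancel when the four swap balances are added crosswise
    rectangle-arithmetic : ∀ {su su' sv sv' ou ou' ov ov' a b c d} →
      su + sv + a + a ≡ ou + ov → su' + sv' + b + b ≡ ou' + ov' →
      su + sv' + c + c ≡ ou + ov' → su' + sv + d + d ≡ ou' + ov → a + b ≡ c + d
    rectangle-arithmetic {su} {su'} {sv} {sv'} {ou} {ou'} {ov} {ov'} {a} {b} {c} {d} e₁ e₂ e₃ e₄ =
      double-injective (+-cancelˡ-≡ (su + sv + su' + sv') _ _ (begin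
        su + sv + su' + sv' + ((a + b) + (a + b))  ≡⟨ regroup₁ su su' sv sv' a b ⟩
        (su + sv + a + a) + (su' + sv' + b + b)    ≡⟨ cong₂ _+_ e₁ e₂ ⟩
        (ou + ov) + (ou' + ov')                    ≡⟨ regroup₂ ou ou' ov ov' ⟩
        (ou + ov') + (ou' + ov)                    ≡⟨ sym (cong₂ _+_ e₃ e₄) ⟩
        (su + sv' + c + c) + (su' + sv + d + d)    ≡⟨ regroup₃ su su' sv sv' c d ⟩
        su + sv + su' + sv' + ((c + d) + (c + d))  ∎))
      where
      open ≡-Reasoning
      regroup₁ : ∀ su su' sv sv' a b → su + sv + su' + sv' + ((a + b) + (a + b)) ≡ (su + sv + a + a) + (su' + sv' + b + b)
      regroup₁ = solve-∀
      regroup₂ : ∀ ou ou' ov ov' → (ou + ov) + (ou' + ov') ≡ (ou + ov') + (ou' + ov)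
      regroup₂ = solve-∀
      regroup₃ : ∀ su su' sv sv' c d → (su + sv' + c + c) + (su' + sv + d + d) ≡ su + sv + su' + sv' + ((c + d) + (c + d))
      regroup₃ = solve-∀

  CrossUniform : Bool → Set
  CrossUniform β = ∀ u u' v → s u ≡ β → s u' ≡ β → s v ≡ not β → adj G u v ≡ adj G u' v

  -- by the rectangle identity the 0/1 matrix of cross adjacencies is a sum of a row and a
  -- column function, so it is constant along one of the two sides
  cross-uniform : CrossUniform true ⊎ CrossUniform false
  cross-uniform with any? (λ u → any? λ u' → any? λ v →
    (s u ≟ᵇ true) ×-dec ((s u' ≟ᵇ true) ×-dec ((s v ≟ᵇ false) ×-dec ((adj G u v ≟ᵇ true) ×-dec (adj G u' v ≟ᵇ false)))))
  ... | no no-witness = inj₁ uniform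
    where
    uniform : CrossUniform true
    uniform u u' v su su' sv with adj G u v in uv | adj G u' v in u'v
    ... | true | true = refl
    ... | false | false = refl
    ... | true | false = ⊥-elim (no-witness (u , u' , v , su , su' , sv , uv , u'v))
    ... | false | true = ⊥-elim (no-witness (u' , u , v , su' , su , sv , u'v , uv))
  ... | yes (u , u' , v , su , su' , sv , uv , u'v) = inj₂ uniform
    where
    svu : ∀ {w} → s w ≡ false → s w ≡ not (s u)
    svu sw = trans sw (cong not (sym su))
    seen : ∀ v' → s v' ≡ false → A v' u ≡ 1 × A v' u' ≡ 0
    seen v' sv' with rectangle u u' v v' (svu sv) (svu sv') (trans su' (sym su))
    ... | e rewrite adj-sym G v u | adj-sym G v u' | uv | u'v | adj-sym G v' u | adj-sym G v' u'
        with adj G u v' | adj G u' v' | e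
    ...   | true | false | _ = refl , refl
    ...   | true | true | ()
    ...   | false | _ | ()
    uniform : CrossUniform false
    uniform x x' y sx sx' sy = b2n-injective (adj G x y) (adj G x' y) (+-cancelʳ-≡ 1 _ _ (begin
      A x y + 1      ≡⟨ cong (A x y +_) (sym (proj₁ (seen x' sx'))) ⟩
      A x y + A x' u ≡⟨ rectangle y u x x' (trans sx (cong not (sym sy))) (trans sx' (cong not (sym sy))) (trans su (sym sy)) ⟩
      A x' y + A x u ≡⟨ cong (A x' y +_) (proj₁ (seen x sx)) ⟩
      A x' y + 1     ∎))
      where open ≡-Reasoning

  module EvenSides (β : Bool) (equal : sideSize s β ≡ sideSize s (not β)) (uniform : CrossUniform β) (w₀ : Fin n) where

    evenN : Even n
    evenN = sideSize s β , sym (trans (cong (sideSize s β +_) equal) (sideSize-+ s β))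

    private
      nonempty : sideSize s β ≢ 0
      nonempty e with subst Fin (trans (sym (sideSize-+ s β)) (cong₂ _+_ e (trans (sym equal) e))) w₀
      ... | ()
      u₀ v₀ : Fin n
      u₀ = proj₁ (nonempty-side s β nonempty)
      v₀ = proj₁ (nonempty-side s (not β) (nonempty ∘ trans equal))
      su₀ : s u₀ ≡ β
      su₀ = proj₂ (nonempty-side s β nonempty)
      sv₀ : s v₀ ≡ not β
      sv₀ = proj₂ (nonempty-side s (not β) (nonempty ∘ trans equal))

    cross : ∀ {u v} → s u ≡ β → s v ≡ not β → s v ≡ not (s u)
    cross su sv = trans sv (cong not (sym su))

    adj-u₀ : ∀ u v → s u ≡ β → s v ≡ not β → adj G u v ≡ adj G u₀ v
    adj-u₀ u v su sv = uniform u u₀ v su su₀ sv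

    other-side : ∀ {v w} → s v ≡ not β → s w ≡ not (s v) → s w ≡ β
    other-side sv sw = trans sw (trans (cong not sv) (not-involutive β))

    no-cross-edges : (∀ v → s v ≡ not β → adj G u₀ v ≡ false) → ⊥
    no-cross-edges none with walk-crosses G s (connected u₀ v₀) (cross su₀ sv₀)
    ... | x , y , xy , sy with ≡-or-≡not β (s x)
    ...   | inj₁ sx with () ← trans (sym xy) (trans (adj-u₀ x y sx (trans sy (cong not sx))) (none y (trans sy (cong not sx))))
    ...   | inj₂ sx with () ← trans (sym xy) (trans (adj-sym G x y) (trans (adj-u₀ y x (other-side sx sy) sx) (none x sx)))

    module AllCross (all-cross : ∀ v → s v ≡ not β → adj G u₀ v ≡ true) where

      cross-adj : ∀ u v → s u ≡ β → s v ≡ not β → adj G u v ≡ true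
      cross-adj u v su sv = trans (adj-u₀ u v su sv) (all-cross v sv)

      full-pair : ∀ u v → s u ≡ β → s v ≡ not β → (S u + 1 ≡ sideSize s (s u)) × (S v + 1 ≡ sideSize s (s v))
      full-pair u v su sv = ≤-+-≡⇒≡ (sameDeg+1≤sideSize s u) (sameDeg+1≤sideSize s v) sizes
                          , ≤-+-≡⇒≡ (sameDeg+1≤sideSize s v) (sameDeg+1≤sideSize s u)
                              (trans (+-comm (S v + 1) _) (trans sizes (+-comm (sideSize s (s u)) _)))
        where
        open ≡-Reasoning
        sizes : S u + 1 + (S v + 1) ≡ sideSize s (s u) + sideSize s (s v)
        sizes = begin
          S u + 1 + (S v + 1)           ≡⟨ regroup (S u) (S v) ⟩
          S u + S v + 1 + 1             ≡⟨ cong (λ a → S u + S v + b2n a + b2n a) (sym (trans (adj-sym G v u) (cross-adj u v su sv))) ⟩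
          S u + S v + A v u + A v u     ≡⟨ balanced-swaps u v (cross su sv) ⟩
          O u + O v                     ≡⟨ cong₂ _+_ (adj⇒crossDeg-full s u λ w sw → cross-adj u w su (trans sw (cong not su)))
                                                     (adj⇒crossDeg-full s v λ w sw → trans (adj-sym G v w) (cross-adj w v (other-side sv sw) sv)) ⟩
          sideSize s (not (s u)) + sideSize s (not (s v)) ≡⟨ cong₂ (λ a b → sideSize s a + sideSize s b) (sym (cross su sv)) (sym (≡not-sym (cross su sv))) ⟩
          sideSize s (s v) + sideSize s (s u) ≡⟨ +-comm (sideSize s (s v)) _ ⟩
          sideSize s (s u) + sideSize s (s v) ∎
          where
          regroup : ∀ a b → a + 1 + (b + 1) ≡ a + b + 1 + 1
          regroup = solve-∀

      complete : IsComplete G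
      complete x y x≢y with ≡-or-≡not β (s x) | ≡-or-≡not (s x) (s y)
      ... | inj₁ sx | inj₁ sy = sameDeg-full⇒adj s x (proj₁ (full-pair x v₀ sx sv₀)) y x≢y sy
      ... | inj₁ sx | inj₂ sy = cross-adj x y sx (trans sy (cong not sx))
      ... | inj₂ sx | inj₁ sy = sameDeg-full⇒adj s x (proj₂ (full-pair u₀ x su₀ sx)) y x≢y sy
      ... | inj₂ sx | inj₂ sy = trans (adj-sym G x y) (cross-adj y x (other-side sx sy) sx)

    -- c is adjacent to side β, v₁ is not: then G is the star centred at c
    module Star (c : Fin n) (sc : s c ≡ not β) (u₀c : adj G u₀ c ≡ true)
                (v₁ : Fin n) (sv₁ : s v₁ ≡ not β) (u₀v₁ : adj G u₀ v₁ ≡ false) where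

      crossDeg-unseen : ∀ v → s v ≡ not β → adj G u₀ v ≡ false → O v ≡ 0
      crossDeg-unseen v sv u₀v = ¬adj⇒crossDeg≡0 s v λ w sw → trans (adj-sym G v w) (trans (adj-u₀ w v (other-side sv sw) sv) u₀v)

      crossDeg-seen : ∀ v → s v ≡ not β → adj G u₀ v ≡ true → O v ≡ sideSize s β
      crossDeg-seen v sv u₀v = trans (adj⇒crossDeg-full s v λ w sw → trans (adj-sym G v w) (trans (adj-u₀ w v (other-side sv sw) sv) u₀v))
                                     (cong (sideSize s) (trans (cong not sv) (not-involutive β)))

      -- comparing the swap balances of u₀ with a seen b and with an unseen v
      seen-unseen : ∀ b v → s b ≡ not β → adj G u₀ b ≡ true → s v ≡ not β → adj G u₀ v ≡ false →
        (S v ≡ 1) × (S b + 1 ≡ sideSize s (s b))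
      seen-unseen b v sb u₀b sv u₀v = S≡1 , full
        where
        with-unseen : S u₀ + S v ≡ O u₀
        with-unseen = begin
          S u₀ + S v                    ≡⟨ sym (trans (+-identityʳ _) (+-identityʳ _)) ⟩
          S u₀ + S v + 0 + 0            ≡⟨ cong (λ a → S u₀ + S v + b2n a + b2n a) (sym (trans (adj-sym G v u₀) u₀v)) ⟩
          S u₀ + S v + A v u₀ + A v u₀  ≡⟨ balanced-swaps u₀ v (cross su₀ sv) ⟩
          O u₀ + O v                    ≡⟨ cong (O u₀ +_) (crossDeg-unseen v sv u₀v) ⟩
          O u₀ + 0                      ≡⟨ +-identityʳ _ ⟩
          O u₀                          ∎
          where open ≡-Reasoning
        with-seen : S b + 2 ≡ S v + sideSize s β
        with-seen = +-cancelˡ-≡ (S u₀) _ _ (begin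
          S u₀ + (S b + 2)              ≡⟨ regroup (S u₀) (S b) ⟩
          S u₀ + S b + 1 + 1            ≡⟨ cong (λ a → S u₀ + S b + b2n a + b2n a) (sym (trans (adj-sym G b u₀) u₀b)) ⟩
          S u₀ + S b + A b u₀ + A b u₀  ≡⟨ balanced-swaps u₀ b (cross su₀ sb) ⟩
          O u₀ + O b                    ≡⟨ cong₂ _+_ (sym with-unseen) (crossDeg-seen b sb u₀b) ⟩
          S u₀ + S v + sideSize s β     ≡⟨ +-assoc (S u₀) _ _ ⟩
          S u₀ + (S v + sideSize s β)   ∎)
          where
          open ≡-Reasoning
          regroup : ∀ a b → a + (b + 2) ≡ a + b + 1 + 1
          regroup = solve-∀
        S≤1 : S v ≤ 1
        S≤1 = +-cancelʳ-≤ (sideSize s β) _ _ (begin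
          S v + sideSize s β            ≡⟨ sym with-seen ⟩
          S b + 2                       ≡⟨ sym (+-assoc (S b) 1 1) ⟩
          S b + 1 + 1                   ≤⟨ +-monoˡ-≤ 1 (sameDeg+1≤sideSize s b) ⟩
          sideSize s (s b) + 1          ≡⟨ cong (λ x → sideSize s x + 1) sb ⟩
          sideSize s (not β) + 1        ≡⟨ cong (_+ 1) (sym equal) ⟩
          sideSize s β + 1              ≡⟨ +-comm _ 1 ⟩
          1 + sideSize s β              ∎)
          where open ≤-Reasoning
        S≡1 : S v ≡ 1
        S≡1 with S v | S≤1 | not-isolated v u₀ (trans su₀ (≡not-sym sv))
        ... | zero | _ | isolated = ⊥-elim (isolated refl (crossDeg-unseen v sv u₀v))
        ... | suc zero | _ | _ = refl
        ... | suc (suc _) | s≤s () | _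
        full : S b + 1 ≡ sideSize s (s b)
        full = +-cancelʳ-≡ 1 _ _ (begin
          S b + 1 + 1                   ≡⟨ +-assoc (S b) 1 1 ⟩
          S b + 2                       ≡⟨ with-seen ⟩
          S v + sideSize s β            ≡⟨ cong (_+ sideSize s β) S≡1 ⟩
          1 + sideSize s β              ≡⟨ +-comm 1 _ ⟩
          sideSize s β + 1              ≡⟨ cong (_+ 1) (trans equal (cong (sideSize s) (sym sb))) ⟩
          sideSize s (s b) + 1          ∎)
          where open ≡-Reasoning

      seen-full : ∀ b → s b ≡ not β → adj G u₀ b ≡ true → ∀ w → b ≢ w → s w ≡ s b → adj G b w ≡ true
      seen-full b sb u₀b = sameDeg-full⇒adj s b (proj₂ (seen-unseen b v₁ sb u₀b sv₁ u₀v₁))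

      S-v₁≡1 : S v₁ ≡ 1
      S-v₁≡1 = proj₁ (seen-unseen c v₁ sc u₀c sv₁ u₀v₁)

      seen≢unseen : ∀ {b} → adj G u₀ b ≡ true → b ≢ v₁
      seen≢unseen u₀b refl with trans (sym u₀b) u₀v₁
      ... | ()

      -- v₁ would be adjacent to two distinct seen vertices
      only-c-seen : ∀ b → s b ≡ not β → adj G u₀ b ≡ true → b ≡ c
      only-c-seen b sb u₀b with b ≟ᶠ c
      ... | yes b≡c = b≡c
      ... | no b≢c = ⊥-elim (<-irrefl refl (≤-trans (2≤sameDeg s v₁ (b≢c ∘ sym) (trans sc (sym sv₁)) (trans sb (sym sv₁))
                                                      (v₁-adj c sc u₀c) (v₁-adj b sb u₀b))
                                          (≤-reflexive S-v₁≡1)))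
        where
        v₁-adj : ∀ b → s b ≡ not β → adj G u₀ b ≡ true → adj G v₁ b ≡ true
        v₁-adj b sb u₀b = trans (adj-sym G v₁ b) (seen-full b sb u₀b v₁ (seen≢unseen u₀b) (trans sv₁ (sym sb)))

      unseen : ∀ v → s v ≡ not β → v ≢ c → adj G u₀ v ≡ false
      unseen v sv v≢c with adj G u₀ v in u₀v
      ... | false = refl
      ... | true = ⊥-elim (v≢c (only-c-seen v sv u₀v))

      centre-adj : ∀ y → c ≢ y → adj G c y ≡ true
      centre-adj y c≢y with ≡-or-≡not β (s y)
      ... | inj₁ sy = trans (adj-sym G c y) (trans (adj-u₀ y c sy sc) u₀c)
      ... | inj₂ sy = seen-full c sc u₀c y c≢y (trans sy (sym sc))

      S≡0 : ∀ u → s u ≡ β → S u ≡ 0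
      S≡0 u su = +-cancelʳ-≡ 1 _ _ (begin
        S u + 1                          ≡⟨ cong (S u +_) (sym S-v₁≡1) ⟩
        S u + S v₁                       ≡⟨ sym (trans (+-identityʳ _) (+-identityʳ _)) ⟩
        S u + S v₁ + 0 + 0               ≡⟨ cong (λ a → S u + S v₁ + b2n a + b2n a) (sym v₁u) ⟩
        S u + S v₁ + A v₁ u + A v₁ u     ≡⟨ balanced-swaps u v₁ (cross su sv₁) ⟩
        O u + O v₁                       ≡⟨ cong₂ _+_ O≡1 (crossDeg-unseen v₁ sv₁ u₀v₁) ⟩
        1                                ∎)
        where
        open ≡-Reasoning
        v₁u : adj G v₁ u ≡ false
        v₁u = trans (adj-sym G v₁ u) (trans (adj-u₀ u v₁ su sv₁) u₀v₁)
        O≡1 : O u ≡ 1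
        O≡1 = crossDeg≡1 s u c (cross su sc) (trans (adj-u₀ u c su sc) u₀c)
                λ w w≢c sw → trans (adj-u₀ u w su (trans sw (cong not su))) (unseen w (trans sw (cong not su)) w≢c)

      off-centre : ∀ x y → x ≢ c → y ≢ c → adj G x y ≡ false
      off-centre x y x≢c y≢c with ≡-or-≡not β (s x) | ≡-or-≡not β (s y)
      ... | inj₁ sx | inj₁ sy = sameDeg≡0⇒¬adj s x (S≡0 x sx) y (trans sy (sym sx))
      ... | inj₁ sx | inj₂ sy = trans (adj-u₀ x y sx sy) (unseen y sy y≢c)
      ... | inj₂ sx | inj₁ sy = trans (adj-sym G x y) (trans (adj-u₀ y x sy sx) (unseen x sx x≢c))
      ... | inj₂ sx | inj₂ sy with adj G x y in xy
      ...   | false = refl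
      ...   | true = ⊥-elim (<-irrefl refl (≤-trans (2≤sameDeg s x (λ c≡y → y≢c (sym c≡y)) (trans sc (sym sx)) (trans sy (sym sx))
                                                  (trans (adj-sym G x c) (centre-adj x (x≢c ∘ sym))) xy)
                                       (≤-reflexive (proj₁ (seen-unseen c x sc u₀c sx (unseen x sx x≢c))))))

      star : IsStar G
      star = c , shape
        where
        shape : ∀ x y → adj G x y ≡ (neq x y ∧ (not (neq x c) ∨ not (neq y c)))
        shape x y with x ≟ᶠ c | y ≟ᶠ c
        ... | yes refl | yes refl rewrite neq-self x = adj-irrefl G x
        ... | yes refl | no y≢c rewrite neq-≢ (y≢c ∘ sym) = centre-adj y (y≢c ∘ sym)
        ... | no x≢c | yes refl rewrite neq-≢ x≢c = trans (adj-sym G x y) (centre-adj x (x≢c ∘ sym))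
        ... | no x≢c | no y≢c rewrite ∧-zeroʳ (neq x y) = off-centre x y x≢c y≢c

    none⇒all-not : ∀ b → ¬ (Σ (Fin n) λ v → s v ≡ not β × adj G u₀ v ≡ b) → ∀ v → s v ≡ not β → adj G u₀ v ≡ not b
    none⇒all-not b none v sv with ≡-or-≡not b (adj G u₀ v)
    ... | inj₁ u₀v = ⊥-elim (none (v , sv , u₀v))
    ... | inj₂ u₀v = u₀v

    star-or-complete : (IsStar G × Even n) ⊎ IsComplete G
    star-or-complete with any? (λ v → (s v ≟ᵇ not β) ×-dec (adj G u₀ v ≟ᵇ false))
    ... | no none-unseen = inj₂ (AllCross.complete (none⇒all-not false none-unseen))
    ... | yes (v₁ , sv₁ , u₀v₁) with any? (λ v → (s v ≟ᵇ not β) ×-dec (adj G u₀ v ≟ᵇ true))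
    ...   | yes (c , sc , u₀c) = inj₁ (Star.star c sc u₀c v₁ sv₁ u₀v₁ , evenN)
    ...   | no none-seen = ⊥-elim (no-cross-edges (none⇒all-not true none-seen))

  star-or-complete : Fin n → sizes-Near s → (∀ β → sideSize s β ≡ suc (sideSize s (not β)) → ∀ v → s v ≡ β → S v ≡ O v) →
    (IsStar G × Even n) ⊎ IsComplete G
  star-or-complete w₀ (inj₁ equal) _ with cross-uniform
  ... | inj₁ uniform = EvenSides.star-or-complete true equal uniform w₀
  ... | inj₂ uniform = EvenSides.star-or-complete false (sym equal) uniform w₀
  star-or-complete _ (inj₂ (inj₁ larger)) moves = inj₂ (Odd.complete true larger (moves true larger))
  star-or-complete _ (inj₂ (inj₂ larger)) moves = inj₂ (Odd.complete false larger (moves false larger))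

-- Stars and complete graphs

negEdges-edgeless : ∀ (X : Graph n) → (∀ i j → adj X i j ≡ false) → ∀ s → negEdges X s ≡ 0
negEdges-edgeless X edgeless s = trans (negEdges≡pairSum X s) (∑-zero λ i → ∑-zero λ j → no-cut i j)
  where
  no-cut : ∀ i j → (if toℕ i <ᵇ toℕ j then cutEdge X s i j else 0) ≡ 0
  no-cut i j rewrite edgeless i j with toℕ i <ᵇ toℕ j
  ... | true = refl
  ... | false = refl

complement-of-complete : ∀ (G : Graph n) → IsComplete G → ∀ i j → adj (complement G) i j ≡ false
complement-of-complete G complete i j with i ≟ᶠ j
... | yes refl = refl
... | no i≢j rewrite complete i j i≢j = refl

sideSize-even : ∀ (s : Partition n) k → n ≡ k + k → Balanced s → ∀ b → sideSize s b ≡ k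
sideSize-even {n} s k n≡k+k bal b with Equivalence.to (Balanced⇔sizes-Near s) bal
... | inj₁ equal = both b
  where
  true≡k : sideSize s true ≡ k
  true≡k = double-injective (trans (cong (sideSize s true +_) equal) (trans (sideSize-+ s true) n≡k+k))
  both : ∀ b → sideSize s b ≡ k
  both true = true≡k
  both false = trans (sym equal) true≡k
... | inj₂ (inj₁ larger) = ⊥-elim (even≢odd′ k (sideSize s false)
  (sym (trans (cong (_+ sideSize s false) (sym larger)) (trans (sideSize-+ s true) n≡k+k))))
... | inj₂ (inj₂ larger) = ⊥-elim (even≢odd′ k (sideSize s true)
  (sym (trans (sym (+-suc (sideSize s true) _)) (trans (cong (sideSize s true +_) (sym larger)) (trans (sideSize-+ s true) n≡k+k)))))

-- the cut edges are exactly those from the centre to the other side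
negEdges-star : ∀ (G : Graph n) → IsStar G → ∀ k → n ≡ k + k → ∀ s → Balanced s → negEdges G s ≡ k
negEdges-star G (c , shape) k n≡k+k s bal = double-injective (begin
  negEdges G s + negEdges G s                   ≡⟨ negEdges-double G s ⟩
  ∑ (crossDeg G s)                              ≡⟨ ∑crossDeg-split G s c ⟩
  crossDeg G s c + crossDeg G s c + cutAvoiding G s c ≡⟨ cong₂ (λ d r → d + d + r) centre off-centre ⟩
  k + k + 0                                     ≡⟨ +-identityʳ _ ⟩
  k + k                                         ∎)
  where
  open ≡-Reasoning
  centre : crossDeg G s c ≡ k
  centre = trans (Degrees.adj⇒crossDeg-full G s c λ w sw → trans (shape c w) (adjacent w λ c≡w → not-¬ (cong s (sym c≡w)) sw))
                 (sideSize-even s k n≡k+k bal (not (s c)))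
    where
    adjacent : ∀ w → c ≢ w → (neq c w ∧ (not (neq c c) ∨ not (neq w c))) ≡ true
    adjacent w c≢w rewrite neq-≢ c≢w | neq-self c = refl
  off-centre : cutAvoiding G s c ≡ 0
  off-centre = ∑-zero λ i → zeroAt-≡0 c (λ i → ∑ (zeroAt c (cutEdge G s i))) i λ i≢c →
                             ∑-zero λ j → zeroAt-≡0 c (cutEdge G s i) j λ j≢c → no-edge i≢c j≢c
    where
    no-edge : ∀ {i j} → i ≢ c → j ≢ c → cutEdge G s i j ≡ 0
    no-edge {i} {j} i≢c j≢c rewrite shape i j | neq-≢ i≢c | neq-≢ j≢c | ∧-zeroʳ (neq i j) = refl

module _ (G : Graph n) where

  private
    Gᶜ K : Graph n
    Gᶜ = complement G
    K = G ∪G Gᶜ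

    split : ∀ s → negEdges G s + negEdges Gᶜ s ≡ negEdges K s
    split = negEdges-∪ G Gᶜ (complement-disjoint G)

  rna+rnaᶜ≤rna : rna G + rna Gᶜ ≤ rna K
  rna+rnaᶜ≤rna = Split.rna+rna≤rna {A = G} {B = Gᶜ} {K = K} split

  complete⇒rna+rnaᶜ≡rna : IsComplete G → rna G + rna Gᶜ ≡ rna K
  complete⇒rna+rnaᶜ≡rna complete = ≤-antisym rna+rnaᶜ≤rna (begin
    rna K           ≤⟨ Split.rna≤rna+rna {A = Gᶜ} {B = G} {K = K} split′ 0 (λ t _ → negEdges-edgeless Gᶜ (complement-of-complete G complete) t) ⟩
    rna Gᶜ + rna G  ≡⟨ +-comm (rna Gᶜ) _ ⟩
    rna G + rna Gᶜ  ∎)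
    where
    open ≤-Reasoning
    split′ : ∀ s → negEdges Gᶜ s + negEdges G s ≡ negEdges K s
    split′ s = trans (+-comm (negEdges Gᶜ s) _) (split s)

  star⇒rna+rnaᶜ≡rna : IsStar G → Even n → rna G + rna Gᶜ ≡ rna K
  star⇒rna+rnaᶜ≡rna star (k , n≡k+k) =
    ≤-antisym rna+rnaᶜ≤rna (Split.rna≤rna+rna {A = G} {B = Gᶜ} {K = K} split k (negEdges-star G star k n≡k+k))

equality⇒star-or-complete : ∀ {n} (G : Graph n) → Connected G → rna G + rna (complement G) ≡ rna (G ∪G complement G) →
  (IsStar G × Even n) ⊎ IsComplete G
equality⇒star-or-complete {zero} G _ _ = inj₂ λ ()
equality⇒star-or-complete {suc n} G connected equality =
  Structure.star-or-complete G connected s (CommonOptimum.swap-balance G optG optGᶜ bal) fzero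
    (Equivalence.to (Balanced⇔sizes-Near s) bal) (CommonOptimum.move-balance G optG optGᶜ)
  where
  common-optimum : Σ (Partition (suc n)) λ s → Balanced s × Optimal G s × Optimal (complement G) s
  common-optimum = Split.common-optimum {A = G} {B = complement G} {K = G ∪G complement G}
    (negEdges-∪ G (complement G) (complement-disjoint G)) equality
  s : Partition (suc n)
  s = proj₁ common-optimum
  bal : Balanced s
  bal = proj₁ (proj₂ common-optimum)
  optG : Optimal G s
  optG = proj₁ (proj₂ (proj₂ common-optimum))
  optGᶜ : Optimal (complement G) s
  optGᶜ = proj₂ (proj₂ (proj₂ common-optimum))

theorem3 : (n : ℕ) (G : Graph n) → Connected G →
    (rna G + rna (complement G) ≤ rna (G ∪G complement G))
    × ((rna G + rna (complement G) ≡ rna (G ∪G complement G))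
        ⇔ ((IsStar G × Even n) ⊎ IsComplete G))
theorem3 n G connected = rna+rnaᶜ≤rna G , mk⇔ (equality⇒star-or-complete G connected) characterised
  where
  characterised : (IsStar G × Even n) ⊎ IsComplete G → rna G + rna (complement G) ≡ rna (G ∪G complement G)
  characterised (inj₁ (star , even)) = star⇒rna+rnaᶜ≡rna G star even
  characterised (inj₂ complete) = complete⇒rna+rnaᶜ≡rna G complete
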